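{- Let $T$ be a tree with $\alpha(T)\ge3$ which has no perfect matching and is not a subdivided star, and let $G$ be a graph. Then an interesting partition $X_1,\dots,X_{\alpha(T)-1}$ of $V(G)$ is $T$-freeness certifying precisely if each $G[X_i]$ is a clique.
   Context: Graphs are finite and simple; $\alpha(\cdot)$ is the stability number. A subdivided star is a tree obtained from a star (tree in which all but one vertex are leaves) by subdividing each edge exactly once. An interesting partition of $V(G)$ (with respect to $T$) is a partition $(X_1,\dots,X_{\alpha(T)-1})$ such that $\alpha(G[X_1])\ge\alpha(G[X_j])$ for all $j\ge2$ and each $G[X_i]$ contains either a clique or a stable set of size $|V(T)|$. A $T$-freeness witnessing partition of $G$ is a partition of $V(G)$ into $\alpha(T)-1$ parts $X_1,\dots,X_{\alpha(T)-1}$ such that for every partition $Y_1,\dots,Y_{\alpha(T)-1}$ of $V(T)$ there is an $i$ with $T[Y_i]$ not an induced subgraph of $G[X_i]$. It is $T$-freeness certifying if moreover (i) $\alpha(G[X_1])\ge\alpha(G[X_i])$ for $i\ge2$; (ii) for $i\ge2$, $G[X_i]$ contains a clique of size $|V(T)|$ and $G[X_1]$ contains a clique or a stable set of size $|V(T)|$; (iii) each $G[X_i]$ is $P_4$-free. -}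

module Defs where

open import Data.Nat using (ℕ; zero; suc; _+_; _≤_)
open import Data.Fin using (Fin; zero; suc; inject₁; fromℕ; splitAt)
open import Data.Bool using (Bool; true; false)
open import Data.Sum using (_⊎_; inj₁; inj₂)
open import Data.Product using (Σ; _×_; _,_)
open import Data.Unit using (⊤)
open import Relation.Nullary using (¬_)
open import Relation.Binary.PropositionalEquality using (_≡_; _≢_)

record Graph (n : ℕ) : Set where
  field
    adj   : Fin n → Fin n → Bool
    sym   : ∀ u v → adj u v ≡ adj v u
    irrefl : ∀ v → adj v v ≡ false
open Graph public

VSet : ℕ → Set₁
VSet n = Fin n → Set

AllV : ∀ {n} → VSet n
AllV _ = ⊤

Part : ∀ {n k} → (Fin n → Fin k) → Fin k → VSet n
Part p i v = p v ≡ i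

Embeds : ∀ {m n} → Graph m → VSet m → Graph n → VSet n → Set
Embeds {m} {n} H Y G X =
  Σ (Fin m → Fin n) λ f →
    (∀ y → Y y → X (f y)) ×
    (∀ y y' → Y y → Y y' → f y ≡ f y' → y ≡ y') ×
    (∀ y y' → Y y → Y y' → adj G (f y) (f y') ≡ adj H y y')

HasClique : ∀ {n} → Graph n → VSet n → ℕ → Set
HasClique {n} G X s =
  Σ (Fin s → Fin n) λ f →
    (∀ i → X (f i)) ×
    (∀ i j → f i ≡ f j → i ≡ j) ×
    (∀ i j → i ≢ j → adj G (f i) (f j) ≡ true)

HasStable : ∀ {n} → Graph n → VSet n → ℕ → Set
HasStable {n} G X s =
  Σ (Fin s → Fin n) λ f →
    (∀ i → X (f i)) ×
    (∀ i j → f i ≡ f j → i ≡ j) ×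
    (∀ i j → i ≢ j → adj G (f i) (f j) ≡ false)

IsAlpha : ∀ {n} → Graph n → VSet n → ℕ → Set
IsAlpha G X a = HasStable G X a × (∀ s → HasStable G X s → s ≤ a)

IsClique : ∀ {n} → Graph n → VSet n → Set
IsClique G X = ∀ u v → X u → X v → u ≢ v → adj G u v ≡ true

P4adj : Fin 4 → Fin 4 → Bool
P4adj zero (suc zero) = true
P4adj (suc zero) zero = true
P4adj (suc zero) (suc (suc zero)) = true
P4adj (suc (suc zero)) (suc zero) = true
P4adj (suc (suc zero)) (suc (suc (suc zero))) = true
P4adj (suc (suc (suc zero))) (suc (suc zero)) = true
P4adj _ _ = false

P4 : Graph 4
P4 = record { adj = P4adj ; sym = s ; irrefl = r }
  where
  s : ∀ u v → P4adj u v ≡ P4adj v u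
  s zero zero = _≡_.refl
  s zero (suc zero) = _≡_.refl
  s zero (suc (suc zero)) = _≡_.refl
  s zero (suc (suc (suc zero))) = _≡_.refl
  s (suc zero) zero = _≡_.refl
  s (suc zero) (suc zero) = _≡_.refl
  s (suc zero) (suc (suc zero)) = _≡_.refl
  s (suc zero) (suc (suc (suc zero))) = _≡_.refl
  s (suc (suc zero)) zero = _≡_.refl
  s (suc (suc zero)) (suc zero) = _≡_.refl
  s (suc (suc zero)) (suc (suc zero)) = _≡_.refl
  s (suc (suc zero)) (suc (suc (suc zero))) = _≡_.refl
  s (suc (suc (suc zero))) zero = _≡_.refl
  s (suc (suc (suc zero))) (suc zero) = _≡_.refl
  s (suc (suc (suc zero))) (suc (suc zero)) = _≡_.refl
  s (suc (suc (suc zero))) (suc (suc (suc zero))) = _≡_.refl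
  r : ∀ v → P4adj v v ≡ false
  r zero = _≡_.refl
  r (suc zero) = _≡_.refl
  r (suc (suc zero)) = _≡_.refl
  r (suc (suc (suc zero))) = _≡_.refl

P4Free : ∀ {n} → Graph n → VSet n → Set
P4Free G X = ¬ Embeds P4 AllV G X

data Walk {n} (G : Graph n) : Fin n → Fin n → Set where
  here : ∀ {v} → Walk G v v
  step : ∀ {u w v} → adj G u w ≡ true → Walk G w v → Walk G u v

Connected : ∀ {n} → Graph n → Set
Connected G = ∀ u v → Walk G u v

-- A cycle of length l+3: distinct vertices f 0, ..., f (l+2), consecutive ones
-- adjacent, and the last adjacent to the first.
HasCycle : ∀ {n} → Graph n → Set
HasCycle {n} G =
  Σ ℕ λ l → Σ (Fin (suc (suc (suc l))) → Fin n) λ f →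
    (∀ i j → f i ≡ f j → i ≡ j) ×
    (∀ (i : Fin (suc (suc l))) → adj G (f (inject₁ i)) (f (suc i)) ≡ true) ×
    (adj G (f (fromℕ (suc (suc l)))) (f zero) ≡ true)

IsTree : ∀ {n} → Graph n → Set
IsTree {n} G = (1 ≤ n) × Connected G × ¬ HasCycle G

-- A perfect matching: each vertex is matched to a neighbour, and matching is
-- symmetric (partner of partner is itself); the edges {v, m v} form the matching.
HasPerfectMatching : ∀ {n} → Graph n → Set
HasPerfectMatching {n} G =
  Σ (Fin n → Fin n) λ m → (∀ v → adj G v (m v) ≡ true) × (∀ v → m (m v) ≡ v)

-- The subdivided star with t branches on vertices Fin (1 + (t + t)):
-- vertex 0 is the centre, the vertices inj₁ i are the subdivision vertices,
-- the vertices inj₂ i are the leaves; edges centre–inj₁ i and inj₁ i–inj₂ i.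
data SSV (t : ℕ) : Set where
  centre : SSV t
  mid    : Fin t → SSV t
  leaf   : Fin t → SSV t

ssClass : ∀ t → Fin (suc (t + t)) → SSV t
ssClass t zero = centre
ssClass t (suc j) with splitAt t j
... | inj₁ i = mid i
... | inj₂ i = leaf i

open import Data.Fin using (_≟_)
open import Relation.Nullary using (yes; no)

ssAdjV : ∀ {t} → SSV t → SSV t → Bool
ssAdjV centre (mid _) = true
ssAdjV (mid _) centre = true
ssAdjV (mid i) (leaf j) with i ≟ j
... | yes _ = true
... | no _ = false
ssAdjV (leaf j) (mid i) with i ≟ j
... | yes _ = true
... | no _ = false
ssAdjV _ _ = false

ssAdjV-sym : ∀ {t} (a b : SSV t) → ssAdjV a b ≡ ssAdjV b a
ssAdjV-sym centre centre = _≡_.refl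
ssAdjV-sym centre (mid _) = _≡_.refl
ssAdjV-sym centre (leaf _) = _≡_.refl
ssAdjV-sym (mid _) centre = _≡_.refl
ssAdjV-sym (mid _) (mid _) = _≡_.refl
ssAdjV-sym (mid i) (leaf j) with i ≟ j
... | yes _ = _≡_.refl
... | no _ = _≡_.refl
ssAdjV-sym (leaf _) centre = _≡_.refl
ssAdjV-sym (leaf j) (mid i) with i ≟ j
... | yes _ = _≡_.refl
... | no _ = _≡_.refl
ssAdjV-sym (leaf _) (leaf _) = _≡_.refl

ssAdjV-irr : ∀ {t} (a : SSV t) → ssAdjV a a ≡ false
ssAdjV-irr centre = _≡_.refl
ssAdjV-irr (mid _) = _≡_.refl
ssAdjV-irr (leaf _) = _≡_.refl

SubdividedStarGraph : (t : ℕ) → Graph (suc (t + t))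
SubdividedStarGraph t = record
  { adj = λ u v → ssAdjV (ssClass t u) (ssClass t v)
  ; sym = λ u v → ssAdjV-sym (ssClass t u) (ssClass t v)
  ; irrefl = λ v → ssAdjV-irr (ssClass t v) }

Isomorphic : ∀ {m n} → Graph m → Graph n → Set
Isomorphic {m} {n} H G =
  Σ (Fin m → Fin n) λ f → Σ (Fin n → Fin m) λ g →
    (∀ x → g (f x) ≡ x) × (∀ y → f (g y) ≡ y) ×
    (∀ x y → adj G (f x) (f y) ≡ adj H x y)

IsSubdividedStar : ∀ {m} → Graph m → Set
IsSubdividedStar T = Σ ℕ λ t → Isomorphic T (SubdividedStarGraph t)

-- Partitions of V(G) into k parts, as part-assignments p : Fin n → Fin k
-- (part i is {v | p v ≡ i}; empty parts allowed).

-- Interesting partition with respect to T (k parts, index zero is X_1).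
Interesting : ∀ {m n k} → Graph m → Graph n → (Fin n → Fin (suc k)) → Set
Interesting {m} T G p =
  (∀ j a₁ aⱼ → IsAlpha G (Part p zero) a₁ → IsAlpha G (Part p j) aⱼ → aⱼ ≤ a₁) ×
  (∀ i → HasClique G (Part p i) m ⊎ HasStable G (Part p i) m)

Witnessing : ∀ {m n k} → Graph m → Graph n → (Fin n → Fin k) → Set
Witnessing {m} {n} {k} T G p =
  ∀ (q : Fin m → Fin k) → Σ (Fin k) λ i → ¬ Embeds T (Part q i) G (Part p i)

Certifying : ∀ {m n k} → Graph m → Graph n → (Fin n → Fin (suc k)) → Set
Certifying {m} T G p =
  Witnessing T G p ×
  (∀ j a₁ aⱼ → IsAlpha G (Part p zero) a₁ → IsAlpha G (Part p j) aⱼ → aⱼ ≤ a₁) ×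
  ((∀ j → HasClique G (Part p (suc j)) m) ×
   (HasClique G (Part p zero) m ⊎ HasStable G (Part p zero) m)) ×
  (∀ i → P4Free G (Part p i))

-- Cliques are certifying: by pigeonhole on a maximum stable set of T, every partition of V(T) into
-- α(T) − 1 parts has a part that is not a clique, and only cliques embed into a clique.
-- Conversely, suppose some part is not a clique. Then one part X_h contains a stable set of size |V(T)|,
-- or a clique of that size and a non-edge, hence a non-edge and an induced P₃ or K₂+K₁; every other part
-- contains a clique of size |V(T)|. A partition of V(T) into α(T) − 1 parts, all cliques except one of the
-- shape available in X_h, would embed part by part and so contradict witnessing. It exists: by König's
-- theorem for forests V(T) is covered by α(T) blocks, the edges of a matching and its exposed vertices, and
-- some vertex w is exposed as T has no perfect matching. Merging w with one or two nearby blocks, after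
-- rematching along an alternating path if necessary, gives the special part; this fails only when every
-- other block has a vertex adjacent to w, that is, when T is a subdivided star centred at w.

module Submission where

open import Defs renaming (sym to adj-sym; irrefl to adj-irrefl)
open import Data.Bool using (Bool; true; false)
open import Data.Bool.Properties using (¬-not) renaming (_≟_ to _≟ᵇ_)
open import Data.Empty using (⊥; ⊥-elim)
open import Data.Unit using (tt)
open import Data.Fin
  using (Fin; zero; suc; toℕ; inject₁; fromℕ; fromℕ<; inject≤; punchOut; punchIn; splitAt; join; _↑ˡ_; _↑ʳ_)
open import Data.Fin.Properties
  using (_≟_; any?; pigeonhole; ¬∀⟶∃¬-smallest; toℕ-injective; toℕ-fromℕ<; toℕ-inject₁; toℕ-fromℕ; toℕ-inject; toℕ<n;
         <⇒≢; inject≤-injective; punchOut-injective; punchOut-cong; punchIn-punchOut; punchOut-punchIn; punchInᵢ≢i;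
         splitAt-↑ˡ; splitAt-↑ʳ; join-splitAt)
open import Data.Nat using (ℕ; zero; suc; _+_; _≤_; _<_; s≤s)
open import Data.Nat.Properties using (n<1+n; +-comm; +-monoˡ-<; <-cmp; m≤n⇒∃[o]m+o≡n)
open import Data.Product using (Σ; _×_; _,_; proj₁; proj₂)
import Data.Product as Product
open import Data.Sum using (_⊎_; inj₁; inj₂)
import Data.Sum as Sum
open import Relation.Binary using (tri<; tri≈; tri>)
open import Relation.Binary.PropositionalEquality
  using (_≡_; _≢_; refl; sym; trans; cong; cong₂; subst; subst₂; ≢-sym; module ≡-Reasoning)
open import Relation.Nullary using (¬_; Dec; yes; no)
open import Relation.Nullary.Decidable using (decidable-stable; ¬?; _×-dec_)
open import Data.Fin.Subset using (Subset; _∈_; _∉_; ⊤; _-_; _⊂_; ⁅_⁆; Empty)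
open import Data.Fin.Subset.Properties using (_∈?_; ∈⊤; nonempty?; x∈p∧x≢y⇒x∈p-y; p─q⊆p; x∈p⇒p-x⊂p; ⊆-⊂-trans)
open import Data.Fin.Subset.Induction using (⊂-wellFounded; Acc; acc)
open import Data.Vec using (_∷_)
open import Data.Vec.Base using (there)
import Data.Fin.Permutation.Components as PC
open import Data.Fin.Permutation using (Permutation′; _⟨$⟩ʳ_; _⟨$⟩ˡ_; inverseˡ; inverseʳ; transpose)

Pair : ∀ {n} → Fin n → Fin n → VSet n
Pair a b v = v ≡ a ⊎ v ≡ b

Triple : ∀ {n} → Fin n → Fin n → Fin n → VSet n
Triple a b c v = v ≡ a ⊎ v ≡ b ⊎ v ≡ c

x∉p-x : ∀ {n} (p : Subset n) x → x ∉ p - x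
x∉p-x (_ ∷ p) (suc x) (there x∈p-x) = x∉p-x p x x∈p-x

transpose-cases : ∀ {n} (i j k : Fin n) →
  (k ≡ i × PC.transpose i j k ≡ j) ⊎ (k ≢ i × k ≡ j × PC.transpose i j k ≡ i) ⊎ (k ≢ i × k ≢ j × PC.transpose i j k ≡ k)
transpose-cases i j k with k ≟ i
... | yes k≡i = inj₁ (k≡i , refl)
... | no k≢i with k ≟ j
...   | yes k≡j = inj₂ (inj₁ (k≢i , k≡j , refl))
...   | no k≢j = inj₂ (inj₂ (k≢i , k≢j , refl))

transpose-matchˡ : ∀ {n} (i j : Fin n) → PC.transpose i j i ≡ j
transpose-matchˡ i j with transpose-cases i j i
... | inj₁ (_ , e) = e
... | inj₂ (inj₁ (i≢i , _)) = ⊥-elim (i≢i refl)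
... | inj₂ (inj₂ (i≢i , _)) = ⊥-elim (i≢i refl)

transpose-matchʳ : ∀ {n} (i j : Fin n) → PC.transpose i j j ≡ i
transpose-matchʳ i j with transpose-cases i j j
... | inj₁ (j≡i , e) = trans e j≡i
... | inj₂ (inj₁ (_ , _ , e)) = e
... | inj₂ (inj₂ (_ , j≢j , _)) = ⊥-elim (j≢j refl)

transpose-other : ∀ {n} {i j k : Fin n} → k ≢ i → k ≢ j → PC.transpose i j k ≡ k
transpose-other {i = i} {j} {k} k≢i k≢j with transpose-cases i j k
... | inj₁ (k≡i , _) = ⊥-elim (k≢i k≡i)
... | inj₂ (inj₁ (_ , k≡j , _)) = ⊥-elim (k≢j k≡j)
... | inj₂ (inj₂ (_ , _ , e)) = e

first-repetition : ∀ {n} (g : ℕ → Fin n) →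
                   Σ ℕ λ i → Σ ℕ λ d → g i ≡ g (suc d + i) × (∀ a b → a < b → b < suc d + i → g a ≢ g b)
first-repetition {n} g with ¬∀⟶∃¬-smallest (suc n) (λ j → ¬ Repeats (toℕ j)) (λ j → ¬? (repeats? (toℕ j))) someRepeat
  where
  Repeats : ℕ → Set
  Repeats j = Σ (Fin j) λ i → g (toℕ i) ≡ g j
  repeats? : ∀ j → Dec (Repeats j)
  repeats? j = any? λ i → g (toℕ i) ≟ g j
  someRepeat : ¬ (∀ j → ¬ Repeats (toℕ j))
  someRepeat none with pigeonhole (n<1+n n) (λ j → g (toℕ j))
  ... | a , b , a<b , e = none b (fromℕ< a<b , trans (cong g (toℕ-fromℕ< a<b)) e)
... | j , repeats , earlier with decidable-stable (any? λ i → g (toℕ i) ≟ g (toℕ j)) repeats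
...   | i , gi≡gj with m≤n⇒∃[o]m+o≡n (toℕ<n i)
...     | d , i+d≡j = toℕ i , d , trans gi≡gj (cong g (sym j≡)) , distinct
  where
  j≡ : suc d + toℕ i ≡ toℕ j
  j≡ = trans (cong suc (+-comm d (toℕ i))) i+d≡j
  fresh : ∀ b → b < toℕ j → ∀ a → a < b → g a ≢ g b
  fresh b b<j a a<b e = earlier (fromℕ< b<j)
    (subst (λ x → Σ (Fin x) λ i → g (toℕ i) ≡ g x) (sym (trans (toℕ-inject (fromℕ< b<j)) (toℕ-fromℕ< b<j)))
           (fromℕ< a<b , trans (cong g (toℕ-fromℕ< a<b)) e))
  distinct : ∀ a b → a < b → b < suc d + toℕ i → g a ≢ g b
  distinct a b a<b b<j = fresh b (subst (b <_) j≡ b<j) a a<b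

module _ {n} (G : Graph n) where

  adj-flip : ∀ {u v b} → adj G u v ≡ b → adj G v u ≡ b
  adj-flip {u} {v} e = trans (adj-sym G v u) e

  edge⇒≢ : ∀ {u v} → adj G u v ≡ true → u ≢ v
  edge⇒≢ {u} e refl with trans (sym e) (adj-irrefl G u)
  ... | ()

  walk-crosses : ∀ (Q : Fin n → Set) → (∀ v → Dec (Q v)) → ∀ {u v} → Walk G u v → ¬ Q u → Q v →
                 Σ (Fin n) λ a → Σ (Fin n) λ b → ¬ Q a × Q b × adj G a b ≡ true
  walk-crosses Q Q? here ¬Qu Qv = ⊥-elim (¬Qu Qv)
  walk-crosses Q Q? {u} (step {w = u′} u~u′ rest) ¬Qu Qv with Q? u′
  ... | yes Qu′ = u , u′ , ¬Qu , Qu′ , u~u′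
  ... | no ¬Qu′ = walk-crosses Q Q? rest ¬Qu′ Qv

  nonBacktracking⇒cycle : (g : ℕ → Fin n) → (∀ i → adj G (g i) (g (suc i)) ≡ true) →
                           (∀ i → g (suc (suc i)) ≢ g i) → HasCycle G
  nonBacktracking⇒cycle g edge nb = closedWalk (first-repetition g)
    where
    closedWalk : (Σ ℕ λ i → Σ ℕ λ d → g i ≡ g (suc d + i) × (∀ a b → a < b → b < suc d + i → g a ≢ g b)) → HasCycle G
    closedWalk (i , zero , e , _) = ⊥-elim (edge⇒≢ (edge i) e)
    closedWalk (i , suc zero , e , _) = ⊥-elim (nb i (sym e))
    closedWalk (i , suc (suc l) , e , distinct) = l , f , f-injective , f-edge , f-closes
      where
      f : Fin (suc (suc (suc l))) → Fin n
      f t = g (toℕ t + i)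
      bound : ∀ t → toℕ t + i < suc (suc (suc l)) + i
      bound t = +-monoˡ-< i (toℕ<n t)
      f-injective : ∀ a b → f a ≡ f b → a ≡ b
      f-injective a b e with <-cmp (toℕ a) (toℕ b)
      ... | tri< a<b _ _ = ⊥-elim (distinct _ _ (+-monoˡ-< i a<b) (bound b) e)
      ... | tri≈ _ a≡b _ = toℕ-injective a≡b
      ... | tri> _ _ b<a = ⊥-elim (distinct _ _ (+-monoˡ-< i b<a) (bound a) (sym e))
      f-edge : ∀ t → adj G (f (inject₁ t)) (f (suc t)) ≡ true
      f-edge t = subst (λ x → adj G (g (x + i)) (g (suc (toℕ t + i))) ≡ true) (sym (toℕ-inject₁ t)) (edge (toℕ t + i))
      f-closes : adj G (f (fromℕ (suc (suc l)))) (f zero) ≡ true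
      f-closes = subst (λ x → adj G (g (x + i)) (g i) ≡ true) (sym (toℕ-fromℕ (suc (suc l))))
                   (subst (λ x → adj G (g (suc (suc (l + i)))) x ≡ true) (sym e) (edge (suc (suc (l + i)))))

module Adjacency {n} (G : Graph n) where

  infix 4 _~_ _≁_
  _~_ _≁_ : Fin n → Fin n → Set
  u ~ v = adj G u v ≡ true
  u ≁ v = adj G u v ≡ false

  ≁⇒¬~ : ∀ {u v} → u ≁ v → ¬ u ~ v
  ≁⇒¬~ u≁v u~v with trans (sym u~v) u≁v
  ... | ()

  StableSet : VSet n → Set
  StableSet Y = ∀ {u v} → Y u → Y v → u ≁ v

  triple-stable : ∀ {a b c} → a ≁ b → a ≁ c → b ≁ c → StableSet (Triple a b c)
  triple-stable {a} _ _ _ (inj₁ refl) (inj₁ refl) = adj-irrefl G a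
  triple-stable ab _ _ (inj₁ refl) (inj₂ (inj₁ refl)) = ab
  triple-stable _ ac _ (inj₁ refl) (inj₂ (inj₂ refl)) = ac
  triple-stable ab _ _ (inj₂ (inj₁ refl)) (inj₁ refl) = adj-flip G ab
  triple-stable {_} {b} _ _ _ (inj₂ (inj₁ refl)) (inj₂ (inj₁ refl)) = adj-irrefl G b
  triple-stable _ _ bc (inj₂ (inj₁ refl)) (inj₂ (inj₂ refl)) = bc
  triple-stable _ ac _ (inj₂ (inj₂ refl)) (inj₁ refl) = adj-flip G ac
  triple-stable _ _ bc (inj₂ (inj₂ refl)) (inj₂ (inj₁ refl)) = adj-flip G bc
  triple-stable {_} {_} {c} _ _ _ (inj₂ (inj₂ refl)) (inj₂ (inj₂ refl)) = adj-irrefl G c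

module Forest {m} (T : Graph m) (acyclic : ¬ HasCycle T) where

  open Adjacency T

  no-cycle₃ : ∀ {a b c} → a ~ b → b ~ c → c ~ a → ⊥
  no-cycle₃ {a} {b} {c} ab bc ca = acyclic (nonBacktracking⇒cycle T g edge nb)
    where
    g : ℕ → Fin m
    g 0 = a
    g 1 = b
    g 2 = c
    g (suc (suc (suc i))) = g i
    edge : ∀ i → g i ~ g (suc i)
    edge 0 = ab
    edge 1 = bc
    edge 2 = ca
    edge (suc (suc (suc i))) = edge i
    nb : ∀ i → g (suc (suc i)) ≢ g i
    nb 0 = edge⇒≢ T ca
    nb 1 = edge⇒≢ T ab
    nb 2 = edge⇒≢ T bc
    nb (suc (suc (suc i))) = nb i

  no-cycle₄ : ∀ {a b c d} → a ~ b → b ~ c → c ~ d → d ~ a → a ≢ c → b ≢ d → ⊥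
  no-cycle₄ {a} {b} {c} {d} ab bc cd da a≢c b≢d = acyclic (nonBacktracking⇒cycle T g edge nb)
    where
    g : ℕ → Fin m
    g 0 = a
    g 1 = b
    g 2 = c
    g 3 = d
    g (suc (suc (suc (suc i)))) = g i
    edge : ∀ i → g i ~ g (suc i)
    edge 0 = ab
    edge 1 = bc
    edge 2 = cd
    edge 3 = da
    edge (suc (suc (suc (suc i)))) = edge i
    nb : ∀ i → g (suc (suc i)) ≢ g i
    nb 0 = ≢-sym a≢c
    nb 1 = ≢-sym b≢d
    nb 2 = a≢c
    nb 3 = b≢d
    nb (suc (suc (suc (suc i)))) = nb i

  no-cycle₅ : ∀ {a b c d e} → a ~ b → b ~ c → c ~ d → d ~ e → e ~ a →
              a ≢ c → b ≢ d → c ≢ e → d ≢ a → e ≢ b → ⊥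
  no-cycle₅ {a} {b} {c} {d} {e} ab bc cd de ea a≢c b≢d c≢e d≢a e≢b = acyclic (nonBacktracking⇒cycle T g edge nb)
    where
    g : ℕ → Fin m
    g 0 = a
    g 1 = b
    g 2 = c
    g 3 = d
    g 4 = e
    g (suc (suc (suc (suc (suc i))))) = g i
    edge : ∀ i → g i ~ g (suc i)
    edge 0 = ab
    edge 1 = bc
    edge 2 = cd
    edge 3 = de
    edge 4 = ea
    edge (suc (suc (suc (suc (suc i))))) = edge i
    nb : ∀ i → g (suc (suc i)) ≢ g i
    nb 0 = ≢-sym a≢c
    nb 1 = ≢-sym b≢d
    nb 2 = ≢-sym c≢e
    nb 3 = ≢-sym d≢a
    nb 4 = ≢-sym e≢b
    nb (suc (suc (suc (suc (suc i))))) = nb i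

  no-cycle₇ : ∀ {a b c d e f h} → a ~ b → b ~ c → c ~ d → d ~ e → e ~ f → f ~ h → h ~ a →
              a ≢ c → b ≢ d → c ≢ e → d ≢ f → e ≢ h → f ≢ a → h ≢ b → ⊥
  no-cycle₇ {a} {b} {c} {d} {e} {f} {h} ab bc cd de ef fh ha a≢c b≢d c≢e d≢f e≢h f≢a h≢b =
    acyclic (nonBacktracking⇒cycle T g edge nb)
    where
    g : ℕ → Fin m
    g 0 = a
    g 1 = b
    g 2 = c
    g 3 = d
    g 4 = e
    g 5 = f
    g 6 = h
    g (suc (suc (suc (suc (suc (suc (suc i))))))) = g i
    edge : ∀ i → g i ~ g (suc i)
    edge 0 = ab
    edge 1 = bc
    edge 2 = cd
    edge 3 = de
    edge 4 = ef
    edge 5 = fh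
    edge 6 = ha
    edge (suc (suc (suc (suc (suc (suc (suc i))))))) = edge i
    nb : ∀ i → g (suc (suc i)) ≢ g i
    nb 0 = ≢-sym a≢c
    nb 1 = ≢-sym b≢d
    nb 2 = ≢-sym c≢e
    nb 3 = ≢-sym d≢f
    nb 4 = ≢-sym e≢h
    nb 5 = ≢-sym f≢a
    nb 6 = ≢-sym h≢b
    nb (suc (suc (suc (suc (suc (suc (suc i))))))) = nb i

  AtMostOneNeighbourIn : Subset m → Fin m → Set
  AtMostOneNeighbourIn S v = ∀ {a b} → a ∈ S → b ∈ S → v ~ a → v ~ b → a ≡ b

  TwoNeighboursIn : Subset m → Fin m → Set
  TwoNeighboursIn S v = Σ (Fin m) λ a → Σ (Fin m) λ b → a ∈ S × b ∈ S × v ~ a × v ~ b × a ≢ b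

  twoNeighboursIn? : ∀ S v → Dec (TwoNeighboursIn S v)
  twoNeighboursIn? S v = any? λ a → any? λ b →
    (a ∈? S) ×-dec (b ∈? S) ×-dec (adj T v a ≟ᵇ true) ×-dec (adj T v b ≟ᵇ true) ×-dec ¬? (a ≟ b)

  twoNeighbours⇒cycle : ∀ S {v₀} → v₀ ∈ S → (∀ {v} → v ∈ S → TwoNeighboursIn S v) → HasCycle T
  twoNeighbours⇒cycle S {v₀} v₀∈S two = nonBacktracking⇒cycle T g (λ i → Step.edge (walk i)) nb
    where
    next : ∀ p {c} → c ∈ S → Σ (Fin m) λ n → n ∈ S × c ~ n × n ≢ p
    next p c∈S with two c∈S
    ... | a , b , a∈S , b∈S , ca , cb , a≢b with a ≟ p
    ...   | yes refl = b , b∈S , cb , ≢-sym a≢b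
    ...   | no a≢p = a , a∈S , ca , a≢p

    record Step : Set where
      field
        prev cur : Fin m
        cur∈S    : cur ∈ S
        edge     : prev ~ cur

    advance : Step → Step
    advance s = let n , n∈S , cur~n , _ = next (Step.prev s) (Step.cur∈S s) in
                record { prev = Step.cur s ; cur = n ; cur∈S = n∈S ; edge = cur~n }

    walk : ℕ → Step
    walk zero = let a , _ , a∈S , _ , v₀~a , _ = two v₀∈S in
                record { prev = v₀ ; cur = a ; cur∈S = a∈S ; edge = v₀~a }
    walk (suc i) = advance (walk i)

    g : ℕ → Fin m
    g i = Step.prev (walk i)

    nb : ∀ i → g (suc (suc i)) ≢ g i
    nb i = let _ , _ , _ , n≢p = next (g i) (Step.cur∈S (walk i)) in n≢p

  exists-atMostOneNeighbourIn : ∀ S {v₀} → v₀ ∈ S → Σ (Fin m) λ v → v ∈ S × AtMostOneNeighbourIn S v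
  exists-atMostOneNeighbourIn S {v₀} v₀∈S with any? (λ v → (v ∈? S) ×-dec ¬? (twoNeighboursIn? S v))
  ... | yes (v , v∈S , ¬two) = v , v∈S , atMostOne
    where
    atMostOne : AtMostOneNeighbourIn S v
    atMostOne {a} {b} a∈S b∈S va vb with a ≟ b
    ... | yes a≡b = a≡b
    ... | no a≢b = ⊥-elim (¬two (a , b , a∈S , b∈S , va , vb , a≢b))
  ... | no none = ⊥-elim (acyclic (twoNeighbours⇒cycle S v₀∈S two))
    where
    two : ∀ {v} → v ∈ S → TwoNeighboursIn S v
    two {v} v∈S with twoNeighboursIn? S v
    ... | yes t = t
    ... | no ¬t = ⊥-elim (none (v , v∈S , ¬t))

  -- König's theorem for forests in certificate form: the stable set rep meets every block {x, partner x}.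
  record KonigCover (S : Subset m) : Set where
    field
      partner            : Fin m → Fin m
      partner-∈          : ∀ {x} → x ∈ S → partner x ∈ S
      partner-involutive : ∀ {x} → x ∈ S → partner (partner x) ≡ x
      partner-adjacent   : ∀ {x} → x ∈ S → partner x ≢ x → x ~ partner x
      size               : ℕ
      rep                : Fin size → Fin m
      rep-∈              : ∀ i → rep i ∈ S
      rep-injective      : ∀ i j → rep i ≡ rep j → i ≡ j
      rep-stable         : ∀ i j → rep i ≁ rep j
      rep-meets          : ∀ {x} → x ∈ S → Σ (Fin size) λ i → rep i ≡ x ⊎ rep i ≡ partner x

  emptyKonigCover : ∀ S → Empty S → KonigCover S
  emptyKonigCover S empty = record
    { partner = λ x → x ; partner-∈ = λ x∈S → x∈S ; partner-involutive = λ _ → refl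
    ; partner-adjacent = λ _ x≢x → ⊥-elim (x≢x refl)
    ; size = 0 ; rep = λ () ; rep-∈ = λ () ; rep-injective = λ () ; rep-stable = λ ()
    ; rep-meets = λ x∈S → ⊥-elim (empty (_ , x∈S)) }

  -- u ≡ v encodes that v is isolated in S.
  module Extension (S : Subset m) {v u} (v∈S : v ∈ S) (u∈S : u ∈ S) (u≡v⊎v~u : u ≡ v ⊎ v ~ u)
                   (onlyU : ∀ {a} → a ∈ S → v ~ a → a ≡ u) (C : KonigCover (S - v - u)) where
    open KonigCover C

    into : ∀ {x} → x ∈ S → x ≢ v → x ≢ u → x ∈ S - v - u
    into x∈S x≢v x≢u = x∈p∧x≢y⇒x∈p-y (x∈p∧x≢y⇒x∈p-y x∈S x≢v) x≢u
    out : ∀ {x} → x ∈ S - v - u → x ∈ S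
    out x∈ = p─q⊆p S ⁅ v ⁆ (p─q⊆p (S - v) ⁅ u ⁆ x∈)
    out≢v : ∀ {x} → x ∈ S - v - u → x ≢ v
    out≢v x∈ refl = x∉p-x S v (p─q⊆p (S - v) ⁅ u ⁆ x∈)
    out≢u : ∀ {x} → x ∈ S - v - u → x ≢ u
    out≢u x∈ refl = x∉p-x (S - v) u x∈

    v~u : u ≢ v → v ~ u
    v~u u≢v = Sum.fromInj₂ (λ u≡v → ⊥-elim (u≢v u≡v)) u≡v⊎v~u

    partner′ : Fin m → Fin m
    partner′ x with x ≟ v | x ≟ u
    ... | yes _ | _     = u
    ... | no _  | yes _ = v
    ... | no _  | no _  = partner x

    partner′-v : partner′ v ≡ u
    partner′-v with v ≟ v
    ... | yes _ = refl
    ... | no v≢v = ⊥-elim (v≢v refl)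

    partner′-u : partner′ u ≡ v
    partner′-u with u ≟ v | u ≟ u
    ... | yes u≡v | _ = u≡v
    ... | no _ | yes _ = refl
    ... | no _ | no u≢u = ⊥-elim (u≢u refl)

    partner′-elsewhere : ∀ {x} → x ≢ v → x ≢ u → partner′ x ≡ partner x
    partner′-elsewhere {x} x≢v x≢u with x ≟ v | x ≟ u
    ... | yes x≡v | _ = ⊥-elim (x≢v x≡v)
    ... | no _ | yes x≡u = ⊥-elim (x≢u x≡u)
    ... | no _ | no _ = refl

    data Position (x : Fin m) : Set where
      at-v      : x ≡ v → Position x
      at-u      : x ≡ u → Position x
      elsewhere : x ∈ S - v - u → Position x

    position : ∀ {x} → x ∈ S → Position x
    position {x} x∈S with x ≟ v | x ≟ u
    ... | yes x≡v | _ = at-v x≡v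
    ... | no _ | yes x≡u = at-u x≡u
    ... | no x≢v | no x≢u = elsewhere (into x∈S x≢v x≢u)

    partner′-∈ : ∀ {x} → x ∈ S → partner′ x ∈ S
    partner′-∈ x∈S with position x∈S
    ... | at-v refl = subst (_∈ S) (sym partner′-v) u∈S
    ... | at-u refl = subst (_∈ S) (sym partner′-u) v∈S
    ... | elsewhere x∈ = subst (_∈ S) (sym (partner′-elsewhere (out≢v x∈) (out≢u x∈))) (out (partner-∈ x∈))

    partner′-involutive : ∀ {x} → x ∈ S → partner′ (partner′ x) ≡ x
    partner′-involutive x∈S with position x∈S
    ... | at-v refl = trans (cong partner′ partner′-v) partner′-u
    ... | at-u refl = trans (cong partner′ partner′-u) partner′-v
    ... | elsewhere x∈ = trans (cong partner′ (partner′-elsewhere (out≢v x∈) (out≢u x∈)))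
                           (trans (partner′-elsewhere (out≢v y∈) (out≢u y∈)) (partner-involutive x∈))
      where y∈ = partner-∈ x∈

    partner′-adjacent : ∀ {x} → x ∈ S → partner′ x ≢ x → x ~ partner′ x
    partner′-adjacent {x} x∈S moved with position x∈S
    ... | at-v refl = subst (x ~_) (sym partner′-v) (v~u (λ u≡v → moved (trans partner′-v u≡v)))
    ... | at-u refl = subst (x ~_) (sym partner′-u) (adj-flip T (v~u (λ u≡v → moved (trans partner′-u (sym u≡v)))))
    ... | elsewhere x∈ = subst (x ~_) (sym p≡) (partner-adjacent x∈ (λ e → moved (trans p≡ e)))
      where p≡ = partner′-elsewhere (out≢v x∈) (out≢u x∈)

    rep′ : Fin (suc size) → Fin m
    rep′ zero = v
    rep′ (suc i) = rep i

    rep′-∈ : ∀ i → rep′ i ∈ S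
    rep′-∈ zero = v∈S
    rep′-∈ (suc i) = out (rep-∈ i)

    rep′-injective : ∀ i j → rep′ i ≡ rep′ j → i ≡ j
    rep′-injective zero zero _ = refl
    rep′-injective zero (suc j) v≡ = ⊥-elim (out≢v (rep-∈ j) (sym v≡))
    rep′-injective (suc i) zero ≡v = ⊥-elim (out≢v (rep-∈ i) ≡v)
    rep′-injective (suc i) (suc j) e = cong suc (rep-injective i j e)

    v≁ : ∀ {x} → x ∈ S - v - u → v ≁ x
    v≁ {x} x∈ = ¬-not λ vx → out≢u x∈ (onlyU (out x∈) vx)

    rep′-stable : ∀ i j → rep′ i ≁ rep′ j
    rep′-stable zero zero = adj-irrefl T v
    rep′-stable zero (suc j) = v≁ (rep-∈ j)
    rep′-stable (suc i) zero = adj-flip T (v≁ (rep-∈ i))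
    rep′-stable (suc i) (suc j) = rep-stable i j

    rep′-meets : ∀ {x} → x ∈ S → Σ (Fin (suc size)) λ i → rep′ i ≡ x ⊎ rep′ i ≡ partner′ x
    rep′-meets x∈S with position x∈S
    ... | at-v refl = zero , inj₁ refl
    ... | at-u refl = zero , inj₂ (sym partner′-u)
    ... | elsewhere x∈ with rep-meets x∈
    ...   | i , inj₁ e = suc i , inj₁ e
    ...   | i , inj₂ e = suc i , inj₂ (trans e (sym (partner′-elsewhere (out≢v x∈) (out≢u x∈))))

    cover : KonigCover S
    cover = record
      { partner = partner′ ; partner-∈ = partner′-∈ ; partner-involutive = partner′-involutive
      ; partner-adjacent = partner′-adjacent
      ; size = suc size ; rep = rep′ ; rep-∈ = rep′-∈ ; rep-injective = rep′-injective
      ; rep-stable = rep′-stable ; rep-meets = rep′-meets }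

  module _ {S} (C : KonigCover S) where
    open KonigCover C

    rep-unique : ∀ {x i j} → x ∈ S → rep i ≡ x ⊎ rep i ≡ partner x → rep j ≡ x ⊎ rep j ≡ partner x → i ≡ j
    rep-unique {x} {i} {j} x∈S ri rj with partner x ≟ x | ri | rj
    ... | _ | inj₁ a | inj₁ b = rep-injective i j (trans a (sym b))
    ... | _ | inj₂ a | inj₂ b = rep-injective i j (trans a (sym b))
    ... | yes px≡x | inj₁ a | inj₂ b = rep-injective i j (trans a (trans (sym px≡x) (sym b)))
    ... | yes px≡x | inj₂ a | inj₁ b = rep-injective i j (trans a (trans px≡x (sym b)))
    ... | no moved | inj₁ a | inj₂ b =
      ⊥-elim (≁⇒¬~ (rep-stable i j) (subst₂ _~_ (sym a) (sym b) (partner-adjacent x∈S moved)))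
    ... | no moved | inj₂ a | inj₁ b =
      ⊥-elim (≁⇒¬~ (rep-stable j i) (subst₂ _~_ (sym b) (sym a) (partner-adjacent x∈S moved)))

    exposed-nonadjacent : ∀ {x y} → x ∈ S → y ∈ S → partner x ≡ x → partner y ≡ y → x ≁ y
    exposed-nonadjacent x∈S y∈S x-exposed y-exposed =
      subst₂ _≁_ (exposedRep x∈S x-exposed) (exposedRep y∈S y-exposed) (rep-stable _ _)
      where
      exposedRep : ∀ {x} (x∈S : x ∈ S) → partner x ≡ x → rep (proj₁ (rep-meets x∈S)) ≡ x
      exposedRep x∈S exposed with rep-meets x∈S
      ... | _ , inj₁ e = e
      ... | _ , inj₂ e = trans e exposed

  konigCover : ∀ S → KonigCover S
  konigCover S = build S (⊂-wellFounded S)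
    where
    build : ∀ S → Acc _⊂_ S → KonigCover S
    build S (acc smaller) with nonempty? S
    ... | no empty = emptyKonigCover S empty
    ... | yes (v₀ , v₀∈S) with exists-atMostOneNeighbourIn S v₀∈S
    ...   | v , v∈S , atMostOne with any? (λ u → (u ∈? S) ×-dec (adj T v u ≟ᵇ true))
    ...     | yes (u , u∈S , vu) = Extension.cover S v∈S u∈S (inj₂ vu) (λ a∈S va → atMostOne a∈S u∈S va vu)
                                     (build _ (smaller (⊆-⊂-trans (p─q⊆p (S - v) ⁅ u ⁆) (x∈p⇒p-x⊂p v∈S))))
    ...     | no isolated = Extension.cover S v∈S v∈S (inj₁ refl) (λ {a} a∈S va → ⊥-elim (isolated (a , a∈S , va)))
                              (build _ (smaller (⊆-⊂-trans (p─q⊆p (S - v) ⁅ v ⁆) (x∈p⇒p-x⊂p v∈S))))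

module Splitting {m} (T : Graph m) where

  open Adjacency T

  Monotone : (VSet m → Set) → Set₁
  Monotone H = ∀ {Y Z : VSet m} → (∀ v → Z v → Y v) → H Y → H Z

  HoldsOnStableSets : (VSet m → Set) → Set₁
  HoldsOnStableSets H = ∀ {Y} → StableSet Y → H Y

  HoldsOnNonEdges HoldsOnInducedP₃ HoldsOnInducedK₂+K₁ : (VSet m → Set) → Set
  HoldsOnNonEdges H = ∀ {a b} → a ≢ b → a ≁ b → H (Pair a b)
  HoldsOnInducedP₃ H = ∀ {a b c} → a ≢ c → a ~ b → b ~ c → a ≁ c → H (Triple a b c)
  HoldsOnInducedK₂+K₁ H = ∀ {a b c} → a ≢ b → a ≢ c → a ≁ b → a ≁ c → b ~ c → H (Triple a b c)

  Capable : (VSet m → Set) → Set₁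
  Capable H = HoldsOnStableSets H ⊎ (HoldsOnNonEdges H × (HoldsOnInducedP₃ H ⊎ HoldsOnInducedK₂+K₁ H))

  record Split (c : ℕ) (H : VSet m → Set) : Set where
    field
      label         : Fin m → Fin c
      special       : Fin c
      clique        : ∀ {u v} → label u ≡ label v → label u ≢ special → u ≢ v → u ~ v
      special-holds : H (Part label special)

  relabel : ∀ {c c′ H} → Monotone H → (S : Split c H) (label′ : Fin m → Fin c′) (special′ : Fin c′) →
            (∀ {u v} → label′ u ≡ label′ v → Split.label S u ≡ Split.label S v) →
            (∀ {u} → Split.label S u ≡ Split.special S → label′ u ≡ special′) →
            (∀ {u} → label′ u ≡ special′ → Split.label S u ≡ Split.special S) → Split c′ H
  relabel mono S label′ special′ same-part to-special from-special = record
    { label = label′ ; special = special′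
    ; clique = λ e ne → Split.clique S (same-part e) (λ l≡s → ne (to-special l≡s))
    ; special-holds = mono (λ v → from-special) (Split.special-holds S) }

  moveSpecial : ∀ {c H} → Monotone H → Split c H → Fin c → Split c H
  moveSpecial mono S i₀ = relabel mono S (λ v → π ⟨$⟩ʳ label v) i₀ π-injective
    (λ l≡s → trans (cong (π ⟨$⟩ʳ_) l≡s) (transpose-matchˡ special i₀))
    (λ e → trans (sym (inverseˡ π)) (trans (cong (π ⟨$⟩ˡ_) e) (transpose-matchˡ i₀ special)))
    where
    open Split S
    π = transpose special i₀
    π-injective : ∀ {x y} → π ⟨$⟩ʳ x ≡ π ⟨$⟩ʳ y → x ≡ y
    π-injective e = trans (sym (inverseˡ π)) (trans (cong (π ⟨$⟩ˡ_) e) (inverseˡ π))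

  dropEmptyPart : ∀ {K c H} → Monotone H → c ≤ K → (S : Split (suc c) H) (j : Fin (suc c)) →
                  (∀ v → j ≢ Split.label S v) → j ≢ Split.special S → Split K H
  dropEmptyPart {K} mono c≤K S j empty j≢special =
    relabel mono S (λ v → shrink (empty v)) (shrink j≢special) shrink-injective
      (λ l≡s → cong (λ x → inject≤ x c≤K) (punchOut-cong j l≡s)) shrink-injective
    where
    shrink : ∀ {x} → j ≢ x → Fin K
    shrink j≢x = inject≤ (punchOut j≢x) c≤K
    shrink-injective : ∀ {x y} {j≢x : j ≢ x} {j≢y : j ≢ y} → shrink j≢x ≡ shrink j≢y → x ≡ y
    shrink-injective {j≢x = j≢x} {j≢y} e = punchOut-injective j≢x j≢y (inject≤-injective c≤K c≤K _ _ e)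

  merge : ∀ {c} → (Fin m → Fin c) → Fin c → Fin c → Fin m → Fin c
  merge label i j v with label v ≟ j
  ... | yes _ = i
  ... | no _ = label v

  merge-cases : ∀ {c} (label : Fin m → Fin c) i j v →
                (label v ≡ j × merge label i j v ≡ i) ⊎ (label v ≢ j × merge label i j v ≡ label v)
  merge-cases label i j v with label v ≟ j
  ... | yes e = inj₁ (e , refl)
  ... | no ne = inj₂ (ne , refl)

  merge-avoids : ∀ {c} (label : Fin m → Fin c) {i j} → i ≢ j → ∀ v → j ≢ merge label i j v
  merge-avoids label {i} {j} i≢j v j≡ with merge-cases label i j v
  ... | inj₁ (_ , e) = i≢j (sym (trans j≡ e))
  ... | inj₂ (ne , e) = ne (sym (trans j≡ e))

  mergeSplit : ∀ {c H} → Monotone H → (label : Fin m → Fin c) {i j : Fin c} →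
               (∀ {u v} → label u ≡ label v → label u ≢ i → label u ≢ j → u ≢ v → u ~ v) →
               H (λ v → label v ≡ i ⊎ label v ≡ j) → Split c H
  mergeSplit mono label {i} {j} clique holds = record
    { label = merge label i j ; special = i ; clique = clique′ ; special-holds = mono merged holds }
    where
    merged : ∀ v → merge label i j v ≡ i → label v ≡ i ⊎ label v ≡ j
    merged v e with merge-cases label i j v
    ... | inj₁ (lv≡j , _) = inj₂ lv≡j
    ... | inj₂ (_ , e′) = inj₁ (trans (sym e′) e)

    clique′ : ∀ {u v} → merge label i j u ≡ merge label i j v → merge label i j u ≢ i → u ≢ v → u ~ v
    clique′ {u} {v} e ne u≢v with merge-cases label i j u | merge-cases label i j v
    ... | inj₁ (_ , mu) | _ = ⊥-elim (ne mu)
    ... | inj₂ _ | inj₁ (_ , mv) = ⊥-elim (ne (trans e mv))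
    ... | inj₂ (lu≢j , mu) | inj₂ (_ , mv) =
      clique (trans (sym mu) (trans e mv)) (λ lu≡i → ne (trans mu lu≡i)) lu≢j u≢v

  splitByMerging : ∀ {K c H} → Monotone H → c ≤ suc K → (label : Fin m → Fin c) {i j : Fin c} → i ≢ j →
                   (∀ {u v} → label u ≡ label v → label u ≢ i → label u ≢ j → u ≢ v → u ~ v) →
                   H (λ v → label v ≡ i ⊎ label v ≡ j) → Split K H
  splitByMerging {c = suc c} mono (s≤s c≤K) label i≢j clique holds =
    dropEmptyPart mono c≤K (mergeSplit mono label clique holds) _ (merge-avoids label i≢j) (≢-sym i≢j)

starIndex : ∀ {t} → SSV t → Fin (suc (t + t))
starIndex centre = zero
starIndex {t} (mid j) = suc (j ↑ˡ t)
starIndex {t} (leaf j) = suc (t ↑ʳ j)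

ssClass-starIndex : ∀ {t} (s : SSV t) → ssClass t (starIndex s) ≡ s
ssClass-starIndex centre = refl
ssClass-starIndex {t} (mid j) rewrite splitAt-↑ˡ t j t = refl
ssClass-starIndex {t} (leaf j) rewrite splitAt-↑ʳ t t j = refl

starIndex-ssClass : ∀ {t} (y : Fin (suc (t + t))) → starIndex (ssClass t y) ≡ y
starIndex-ssClass zero = refl
starIndex-ssClass {t} (suc y) with splitAt t y in eq
... | inj₁ j = cong suc (trans (cong (join t t) (sym eq)) (join-splitAt t t y))
... | inj₂ j = cong suc (trans (cong (join t t) (sym eq)) (join-splitAt t t y))

ssAdjV-mid-leaf : ∀ {t} (i j : Fin t) →
  (i ≡ j × ssAdjV (mid i) (leaf j) ≡ true) ⊎ (i ≢ j × ssAdjV (mid i) (leaf j) ≡ false)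
ssAdjV-mid-leaf i j with i ≟ j
... | yes i≡j = inj₁ (i≡j , refl)
... | no i≢j = inj₂ (i≢j , refl)

subdividedStar-from : ∀ {m t} (T : Graph m) (classify : Fin m → SSV t) (vertex : SSV t → Fin m) →
  (∀ x → vertex (classify x) ≡ x) → (∀ s → classify (vertex s) ≡ s) →
  (∀ x y → ssAdjV (classify x) (classify y) ≡ adj T x y) → IsSubdividedStar T
subdividedStar-from {t = t} T classify vertex vertex-classify classify-vertex classify-adj =
  t , (λ x → starIndex (classify x)) , (λ y → vertex (ssClass t y))
    , (λ x → trans (cong vertex (ssClass-starIndex (classify x))) (vertex-classify x))
    , (λ y → trans (cong starIndex (classify-vertex (ssClass t y))) (starIndex-ssClass y))
    , (λ x y → trans (cong₂ ssAdjV (ssClass-starIndex (classify x)) (ssClass-starIndex (classify y)))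
                     (classify-adj x y))

module Blocks {m} (T : Graph m) (acyclic : ¬ HasCycle T) (k : ℕ)
              (α-max : ∀ s → HasStable T AllV s → s ≤ suc (suc (suc k))) where

  open Adjacency T
  open Forest T acyclic
  open Splitting T

  -- x is exposed (unmatched) when partner x ≡ x.
  record BlockPartition (blocks : ℕ) : Set where
    field
      block              : Fin m → Fin blocks
      partner            : Fin m → Fin m
      partner-involutive : ∀ x → partner (partner x) ≡ x
      partner-adjacent   : ∀ x → partner x ≢ x → x ~ partner x
      block-partner      : ∀ x → block (partner x) ≡ block x
      block-injective    : ∀ {x y} → block x ≡ block y → x ≡ y ⊎ x ≡ partner y
      block-surjective   : ∀ i → Σ (Fin m) λ x → block x ≡ i
      blocks≤α           : blocks ≤ suc (suc (suc k))

  konigBlockPartition : (C : KonigCover ⊤) → BlockPartition (KonigCover.size C)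
  konigBlockPartition C = record
    { block = block ; partner = partner
    ; partner-involutive = λ x → partner-involutive ∈⊤ ; partner-adjacent = λ x → partner-adjacent ∈⊤
    ; block-partner = block-partner ; block-injective = block-injective
    ; block-surjective = λ i → rep i , rep-unique C ∈⊤ (meets (rep i)) (inj₁ refl)
    ; blocks≤α = α-max size (rep , (λ _ → tt) , rep-injective , λ i j _ → rep-stable i j) }
    where
    open KonigCover C

    block : Fin m → Fin size
    block x = proj₁ (rep-meets (∈⊤ {x = x}))

    meets : ∀ x → rep (block x) ≡ x ⊎ rep (block x) ≡ partner x
    meets x = proj₂ (rep-meets ∈⊤)

    block-partner : ∀ x → block (partner x) ≡ block x
    block-partner x = rep-unique C ∈⊤ (swap (meets (partner x))) (meets x)
      where
      swap : rep (block (partner x)) ≡ partner x ⊎ rep (block (partner x)) ≡ partner (partner x) →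
             rep (block (partner x)) ≡ x ⊎ rep (block (partner x)) ≡ partner x
      swap (inj₁ e) = inj₂ e
      swap (inj₂ e) = inj₁ (trans e (partner-involutive ∈⊤))

    block-injective : ∀ {x y} → block x ≡ block y → x ≡ y ⊎ x ≡ partner y
    block-injective {x} {y} e with meets x | meets y
    ... | inj₁ a | inj₁ b = inj₁ (trans (sym a) (trans (cong rep e) b))
    ... | inj₁ a | inj₂ b = inj₂ (trans (sym a) (trans (cong rep e) b))
    ... | inj₂ a | inj₁ b = inj₂ (trans (sym (partner-involutive ∈⊤))
                                  (cong partner (trans (sym a) (trans (cong rep e) b))))
    ... | inj₂ a | inj₂ b = inj₁ (trans (sym (partner-involutive ∈⊤))
                                  (trans (cong partner (trans (sym a) (trans (cong rep e) b))) (partner-involutive ∈⊤)))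

  module _ {c} (P : BlockPartition c) where
    open BlockPartition P

    partner-injective : ∀ {x y} → partner x ≡ partner y → x ≡ y
    partner-injective {x} {y} e = trans (sym (partner-involutive x)) (trans (cong partner e) (partner-involutive y))

    block-clique : ∀ {x y} → block x ≡ block y → x ≢ y → x ~ y
    block-clique {x} {y} e x≢y with block-injective e
    ... | inj₁ x≡y = ⊥-elim (x≢y x≡y)
    ... | inj₂ x≡py = subst (_~ y) (sym x≡py) (adj-flip T (partner-adjacent y (λ py≡y → x≢y (trans x≡py py≡y))))

    exposed-block : ∀ {w x} → partner w ≡ w → block x ≡ block w → x ≡ w
    exposed-block w-exposed e with block-injective e
    ... | inj₁ x≡w = x≡w
    ... | inj₂ x≡pw = trans x≡pw w-exposed

    mergeWith : ∀ {H w x} → Monotone H → partner w ≡ w → x ≢ w → H (Triple w x (partner x)) →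
                Split (suc (suc k)) H
    mergeWith {H} {w} {x} mono w-exposed x≢w holds =
      splitByMerging mono blocks≤α block (λ e → x≢w (exposed-block w-exposed (sym e)))
        (λ e _ _ → block-clique e) (mono inTriple holds)
      where
      inTriple : ∀ v → block v ≡ block w ⊎ block v ≡ block x → Triple w x (partner x) v
      inTriple v (inj₁ e) = inj₁ (exposed-block w-exposed e)
      inTriple v (inj₂ e) = inj₂ (block-injective e)

  conjugatePartner : ∀ {c} → BlockPartition c → Permutation′ m → Fin m → Fin m
  conjugatePartner P σ x = σ ⟨$⟩ˡ BlockPartition.partner P (σ ⟨$⟩ʳ x)

  conjugate : ∀ {c} (P : BlockPartition c) (σ : Permutation′ m) →
              (∀ x → conjugatePartner P σ x ≢ x → x ~ conjugatePartner P σ x) → BlockPartition c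
  conjugate P σ adjacent = record
    { block = λ x → block (σ ⟨$⟩ʳ x) ; partner = conjugatePartner P σ
    ; partner-involutive = involutive ; partner-adjacent = adjacent
    ; block-partner = λ x → trans (cong block (inverseʳ σ)) (block-partner (σ ⟨$⟩ʳ x))
    ; block-injective = λ e → Sum.map σ-injective (λ e′ → trans (sym (inverseˡ σ)) (cong (σ ⟨$⟩ˡ_) e′))
                                      (block-injective e)
    ; block-surjective = surjective ; blocks≤α = blocks≤α }
    where
    open BlockPartition P
    open ≡-Reasoning

    involutive : ∀ x → conjugatePartner P σ (conjugatePartner P σ x) ≡ x
    involutive x = begin
      σ ⟨$⟩ˡ partner (σ ⟨$⟩ʳ (σ ⟨$⟩ˡ partner (σ ⟨$⟩ʳ x))) ≡⟨ cong (λ y → σ ⟨$⟩ˡ partner y) (inverseʳ σ) ⟩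
      σ ⟨$⟩ˡ partner (partner (σ ⟨$⟩ʳ x))                 ≡⟨ cong (σ ⟨$⟩ˡ_) (partner-involutive _) ⟩
      σ ⟨$⟩ˡ (σ ⟨$⟩ʳ x)                                   ≡⟨ inverseˡ σ ⟩
      x                                                   ∎

    σ-injective : ∀ {x y} → σ ⟨$⟩ʳ x ≡ σ ⟨$⟩ʳ y → x ≡ y
    σ-injective e = trans (sym (inverseˡ σ)) (trans (cong (σ ⟨$⟩ˡ_) e) (inverseˡ σ))

    surjective : ∀ i → Σ (Fin m) λ x → block (σ ⟨$⟩ʳ x) ≡ i
    surjective i with block-surjective i
    ... | x , e = σ ⟨$⟩ˡ x , trans (cong block (inverseʳ σ)) e

  module UniquelyExposed {c} (P : BlockPartition c) (w : Fin m) (w-exposed : BlockPartition.partner P w ≡ w)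
                         (w-unique : ∀ x → BlockPartition.partner P x ≡ x → x ≡ w) where
    open BlockPartition P

    moved : ∀ {x} → x ≢ w → partner x ≢ x
    moved x≢w px≡x = x≢w (w-unique _ px≡x)

    partner≢w : ∀ {x} → x ≢ w → partner x ≢ w
    partner≢w x≢w px≡w = x≢w (partner-injective P (trans px≡w (sym w-exposed)))

    ~partner : ∀ {x} → x ≢ w → x ~ partner x
    ~partner x≢w = partner-adjacent _ (moved x≢w)

    neighbour≢w : ∀ {z} → w ~ z → z ≢ w
    neighbour≢w w~z = ≢-sym (edge⇒≢ T w~z)

    -- The blocks {x, partner x} and {y, partner y} become {x, y}, while partner x and partner y join w.
    module Crossing {x y} (x~y : x ~ y) (x≢w : x ≢ w) (y≢w : y ≢ w) (y≢px : y ≢ partner x) where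
      x≢py : x ≢ partner y
      x≢py x≡py = y≢px (trans (sym (partner-involutive y)) (cong partner (sym x≡py)))

      px≁py : partner x ≁ partner y
      px≁py = ¬-not λ px~py →
        no-cycle₄ (~partner x≢w) px~py (adj-flip T (~partner y≢w)) (adj-flip T x~y) x≢py (≢-sym y≢px)

      label′ : Fin m → Fin c
      label′ v = block (PC.transpose y (partner x) v)

      block-x : block x ≢ block w × block x ≢ block y
      block-x = (λ e → x≢w (exposed-block P w-exposed e))
              , (λ e → Sum.[ edge⇒≢ T x~y , x≢py ]′ (block-injective e))

      clique′ : ∀ {u v} → label′ u ≡ label′ v → label′ u ≢ block w → label′ u ≢ block y → u ≢ v → u ~ v
      clique′ {u} {v} e _ ≢by u≢v with transpose-cases y (partner x) u | transpose-cases y (partner x) v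
      ... | inj₂ (inj₁ (_ , _ , t)) | _ = ⊥-elim (≢by (cong block t))
      ... | _ | inj₂ (inj₁ (_ , _ , t)) = ⊥-elim (≢by (trans e (cong block t)))
      ... | inj₁ (refl , _) | inj₁ (refl , _) = ⊥-elim (u≢v refl)
      ... | inj₁ (refl , t) | inj₂ (inj₂ (_ , v≢px , t′)) =
        Sum.[ (λ v≡x → subst (u ~_) (sym v≡x) (adj-flip T x~y)) , (λ v≡px → ⊥-elim (v≢px v≡px)) ]′
          (block-injective (trans (sym (cong block t′)) (trans (sym e) (trans (cong block t) (block-partner x)))))
      ... | inj₂ (inj₂ (_ , u≢px , t)) | inj₁ (refl , t′) =
        Sum.[ (λ u≡x → subst (_~ v) (sym u≡x) x~y) , (λ u≡px → ⊥-elim (u≢px u≡px)) ]′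
          (block-injective (trans (sym (cong block t)) (trans e (trans (cong block t′) (block-partner x)))))
      ... | inj₂ (inj₂ (_ , _ , t)) | inj₂ (inj₂ (_ , _ , t′)) =
        block-clique P (trans (sym (cong block t)) (trans e (cong block t′))) u≢v

      inTriple : ∀ v → label′ v ≡ block w ⊎ label′ v ≡ block y → Triple w (partner x) (partner y) v
      inTriple v l with transpose-cases y (partner x) v
      ... | inj₁ (_ , t) = ⊥-elim (Sum.[ proj₁ block-x , proj₂ block-x ]′
                                        (Sum.map (trans (sym (trans (cong block t) (block-partner x))))
                                                 (trans (sym (trans (cong block t) (block-partner x)))) l))
      ... | inj₂ (inj₁ (_ , v≡px , _)) = inj₂ (inj₁ v≡px)
      ... | inj₂ (inj₂ (v≢y , _ , t)) with Sum.map (trans (sym (cong block t))) (trans (sym (cong block t))) l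
      ...   | inj₁ bv≡bw = inj₁ (exposed-block P w-exposed bv≡bw)
      ...   | inj₂ bv≡by = Sum.[ (λ v≡y → ⊥-elim (v≢y v≡y)) , (λ v≡py → inj₂ (inj₂ v≡py)) ]′ (block-injective bv≡by)

      split : ∀ {H} → Monotone H → HoldsOnStableSets H → w ≁ partner x → w ≁ partner y → Split (suc (suc k)) H
      split mono onStable w≁px w≁py =
        splitByMerging mono blocks≤α label′ (λ e → y≢w (exposed-block P w-exposed (sym e))) clique′
          (mono inTriple (onStable (triple-stable w≁px w≁py px≁py)))

    crossPair : ∀ {H x y} → Monotone H → HoldsOnStableSets H → x ~ y → x ≢ w → y ≢ w → y ≢ partner x →
                w ≁ partner x → w ≁ partner y → Split (suc (suc k)) H
    crossPair mono onStable x~y x≢w y≢w y≢px = Crossing.split x~y x≢w y≢w y≢px mono onStable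

    -- Conjugating by the transposition (w  partner z) swaps the matching along the path w, z, partner z.
    module Rematching {z} (w~z : w ~ z) where
      σ : Permutation′ m
      σ = transpose w (partner z)

      z≢w : z ≢ w
      z≢w = neighbour≢w w~z

      pz≢z : partner z ≢ z
      pz≢z = moved z≢w

      at-w : conjugatePartner P σ w ≡ z
      at-w = trans (cong (λ y → σ ⟨$⟩ˡ partner y) (transpose-matchˡ w (partner z)))
                   (trans (cong (σ ⟨$⟩ˡ_) (partner-involutive z)) (transpose-other (≢-sym pz≢z) z≢w))

      at-z : conjugatePartner P σ z ≡ w
      at-z = trans (cong (λ y → σ ⟨$⟩ˡ partner y) (transpose-other z≢w (≢-sym pz≢z))) (transpose-matchˡ (partner z) w)

      pz-exposed : conjugatePartner P σ (partner z) ≡ partner z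
      pz-exposed = trans (cong (λ y → σ ⟨$⟩ˡ partner y) (transpose-matchʳ w (partner z)))
                    (trans (cong (σ ⟨$⟩ˡ_) w-exposed) (transpose-matchʳ (partner z) w))

      unchanged : ∀ {x} → x ≢ w → x ≢ z → x ≢ partner z → conjugatePartner P σ x ≡ partner x
      unchanged x≢w x≢z x≢pz = trans (cong (λ y → σ ⟨$⟩ˡ partner y) (transpose-other x≢w x≢pz))
                                    (transpose-other (λ e → x≢z (partner-injective P e)) (partner≢w x≢w))

      data Place (x : Fin m) : Set where
        is-w      : x ≡ w → Place x
        is-z      : x ≡ z → Place x
        is-pz     : x ≡ partner z → Place x
        elsewhere : x ≢ w → x ≢ z → x ≢ partner z → Place x

      place : ∀ x → Place x
      place x with x ≟ w | x ≟ z | x ≟ partner z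
      ... | yes e | _ | _ = is-w e
      ... | no _ | yes e | _ = is-z e
      ... | no _ | no _ | yes e = is-pz e
      ... | no x≢w | no x≢z | no x≢pz = elsewhere x≢w x≢z x≢pz

      adjacent′ : ∀ x → conjugatePartner P σ x ≢ x → x ~ conjugatePartner P σ x
      adjacent′ x stays with place x
      ... | is-w refl = subst (x ~_) (sym at-w) w~z
      ... | is-z refl = subst (x ~_) (sym at-z) (adj-flip T w~z)
      ... | is-pz refl = ⊥-elim (stays pz-exposed)
      ... | elsewhere x≢w x≢z x≢pz = subst (x ~_) (sym (unchanged x≢w x≢z x≢pz)) (~partner x≢w)

      pz-unique : ∀ x → conjugatePartner P σ x ≡ x → x ≡ partner z
      pz-unique x fixed with place x
      ... | is-w refl = ⊥-elim (z≢w (trans (sym at-w) fixed))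
      ... | is-z refl = ⊥-elim (z≢w (sym (trans (sym at-z) fixed)))
      ... | is-pz x≡pz = x≡pz
      ... | elsewhere x≢w x≢z x≢pz = ⊥-elim (moved x≢w (trans (sym (unchanged x≢w x≢z x≢pz)) fixed))

      P′ : BlockPartition c
      P′ = conjugate P σ adjacent′

  -- Each block other than {w} is a branch: its vertex adjacent to w is the middle vertex, the other the leaf.
  module Star {t} (P : BlockPartition (suc t)) (w : Fin m) (w-exposed : BlockPartition.partner P w ≡ w)
              (w-unique : ∀ x → BlockPartition.partner P x ≡ x → x ≡ w)
              (near : ∀ x → x ≢ w → w ~ x ⊎ w ~ BlockPartition.partner P x) where
    open BlockPartition P
    open UniquelyExposed P w w-exposed w-unique

    blockw≢block : ∀ {x} → x ≢ w → block w ≢ block x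
    blockw≢block x≢w e = x≢w (exposed-block P w-exposed (sym e))

    branch : ∀ {x} → x ≢ w → Fin t
    branch x≢w = punchOut (blockw≢block x≢w)

    branch-of : ∀ {x} (x≢w : x ≢ w) {i} → block x ≡ punchIn (block w) i → branch x≢w ≡ i
    branch-of x≢w e = trans (punchOut-cong (block w) e) (punchOut-punchIn (block w))

    towardsCentre : Fin m → Fin m
    towardsCentre x with adj T w x
    ... | true = x
    ... | false = partner x

    towardsCentre-spec : ∀ {x} → x ≢ w → block (towardsCentre x) ≡ block x × w ~ towardsCentre x
    towardsCentre-spec {x} x≢w with adj T w x in w?x
    ... | true = refl , w?x
    ... | false = block-partner x , Sum.fromInj₂ (λ w~x → ⊥-elim (≁⇒¬~ w?x w~x)) (near x x≢w)

    midOf : Fin t → Fin m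
    midOf i = towardsCentre (proj₁ (block-surjective (punchIn (block w) i)))

    midOf-spec : ∀ i → block (midOf i) ≡ punchIn (block w) i × w ~ midOf i
    midOf-spec i with block-surjective (punchIn (block w) i)
    ... | x , bx = Product.map₁ (λ e → trans e bx) (towardsCentre-spec x≢w)
      where
      x≢w : x ≢ w
      x≢w x≡w = punchInᵢ≢i (block w) i (trans (sym bx) (cong block x≡w))

    block-midOf : ∀ i → block (midOf i) ≡ punchIn (block w) i
    block-midOf i = proj₁ (midOf-spec i)

    w~midOf : ∀ i → w ~ midOf i
    w~midOf i = proj₂ (midOf-spec i)

    midOf≢w : ∀ i → midOf i ≢ w
    midOf≢w i = neighbour≢w (w~midOf i)

    vertex : SSV t → Fin m
    vertex centre = w
    vertex (mid i) = midOf i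
    vertex (leaf i) = partner (midOf i)

    data Kind (x : Fin m) : Set where
      centre-kind : x ≡ w → Kind x
      mid-kind    : (x≢w : x ≢ w) → w ~ x → Kind x
      leaf-kind   : (x≢w : x ≢ w) → w ≁ x → Kind x

    kind : ∀ x → Kind x
    kind x with x ≟ w | adj T w x in w?x
    ... | yes x≡w | _ = centre-kind x≡w
    ... | no x≢w | true = mid-kind x≢w w?x
    ... | no x≢w | false = leaf-kind x≢w w?x

    classOf : ∀ {x} → Kind x → SSV t
    classOf (centre-kind _) = centre
    classOf (mid-kind x≢w _) = mid (branch x≢w)
    classOf (leaf-kind x≢w _) = leaf (branch x≢w)

    classify : Fin m → SSV t
    classify x = classOf (kind x)

    midOf-branch : ∀ {x} (x≢w : x ≢ w) → block (midOf (branch x≢w)) ≡ block x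
    midOf-branch x≢w = trans (block-midOf _) (punchIn-punchOut (blockw≢block x≢w))

    vertex-classify : ∀ x → vertex (classify x) ≡ x
    vertex-classify x with kind x
    ... | centre-kind x≡w = sym x≡w
    ... | mid-kind x≢w w~x =
      Sum.fromInj₁ (λ e → ⊥-elim (no-cycle₃ w~x (~partner x≢w) (adj-flip T (subst (w ~_) e (w~midOf _)))))
                   (block-injective (midOf-branch x≢w))
    ... | leaf-kind x≢w w≁x = Sum.[ (λ e → ⊥-elim (≁⇒¬~ w≁x (subst (w ~_) e (w~midOf _))))
                                  , (λ e → trans (cong partner e) (partner-involutive x)) ]′
                                (block-injective (midOf-branch x≢w))

    classify-vertex : ∀ s → classify (vertex s) ≡ s
    classify-vertex centre with kind w
    ... | centre-kind _ = refl
    ... | mid-kind w≢w _ = ⊥-elim (w≢w refl)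
    ... | leaf-kind w≢w _ = ⊥-elim (w≢w refl)
    classify-vertex (mid i) with kind (midOf i)
    ... | centre-kind e = ⊥-elim (midOf≢w i e)
    ... | mid-kind x≢w _ = cong mid (branch-of x≢w (block-midOf i))
    ... | leaf-kind _ w≁x = ⊥-elim (≁⇒¬~ w≁x (w~midOf i))
    classify-vertex (leaf i) with kind (partner (midOf i))
    ... | centre-kind e = ⊥-elim (partner≢w (midOf≢w i) e)
    ... | mid-kind _ w~pm = ⊥-elim (no-cycle₃ (w~midOf i) (~partner (midOf≢w i)) (adj-flip T w~pm))
    ... | leaf-kind x≢w _ = cong leaf (branch-of x≢w (trans (block-partner _) (block-midOf i)))

    w~partner : ∀ {v} → v ≢ w → w ≁ v → w ~ partner v
    w~partner {v} v≢w w≁v = Sum.fromInj₂ (λ w~v → ⊥-elim (≁⇒¬~ w≁v w~v)) (near v v≢w)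

    mid-leaf-adj : ∀ {x y} (x≢w : x ≢ w) (y≢w : y ≢ w) → w ~ x → w ≁ y →
                   ssAdjV (mid (branch x≢w)) (leaf (branch y≢w)) ≡ adj T x y
    mid-leaf-adj {x} {y} x≢w y≢w w~x w≁y with ssAdjV-mid-leaf (branch x≢w) (branch y≢w)
    ... | inj₁ (same , e) = trans e (Sum.[ (λ x≡y → ⊥-elim (≁⇒¬~ w≁y (subst (w ~_) x≡y w~x)))
                                         , (λ x≡py → sym (subst (_~ y) (sym x≡py) (adj-flip T (~partner y≢w)))) ]′
                                       (block-injective (punchOut-injective (blockw≢block x≢w) (blockw≢block y≢w) same)))
    ... | inj₂ (different , e) = trans e (sym (¬-not λ x~y → no-cycle₄ w~x x~y (~partner y≢w) (adj-flip T w~py)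
                                   (≢-sym y≢w) (λ x≡py → different (cong-branch x≡py))))
      where
      w~py : w ~ partner y
      w~py = w~partner y≢w w≁y
      cong-branch : x ≡ partner y → branch x≢w ≡ branch y≢w
      cong-branch x≡py = punchOut-cong (block w) (trans (cong block x≡py) (block-partner y))

    leaf-leaf-nonadjacent : ∀ {x y} → x ≢ w → y ≢ w → w ≁ x → w ≁ y → x ≁ y
    leaf-leaf-nonadjacent {x} {y} x≢w y≢w w≁x w≁y = ¬-not adjacent
      where
      adjacent : ¬ x ~ y
      adjacent x~y with block x ≟ block y
      ... | yes same = Sum.[ edge⇒≢ T x~y , (λ x≡py → ≁⇒¬~ w≁x (subst (w ~_) (sym x≡py) (w~partner y≢w w≁y))) ]′
                         (block-injective same)
      ... | no different =
        no-cycle₅ (w~partner x≢w w≁x) (adj-flip T (~partner x≢w)) x~y (~partner y≢w) (adj-flip T (w~partner y≢w w≁y))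
          (≢-sym x≢w) (λ px≡y → different (trans (sym (block-partner x)) (cong block px≡y)))
          (λ x≡py → different (trans (cong block x≡py) (block-partner y))) y≢w
          (λ py≡px → different (cong block (partner-injective P (sym py≡px))))

    classify-adj : ∀ x y → ssAdjV (classify x) (classify y) ≡ adj T x y
    classify-adj x y with kind x | kind y
    ... | centre-kind refl | centre-kind refl = sym (adj-irrefl T x)
    ... | centre-kind refl | mid-kind _ w~y = sym w~y
    ... | centre-kind refl | leaf-kind _ w≁y = sym w≁y
    ... | mid-kind _ w~x | centre-kind refl = sym (adj-flip T w~x)
    ... | leaf-kind _ w≁x | centre-kind refl = sym (adj-flip T w≁x)
    ... | mid-kind _ w~x | mid-kind _ w~y = sym (¬-not λ x~y → no-cycle₃ w~x x~y (adj-flip T w~y))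
    ... | mid-kind x≢w w~x | leaf-kind y≢w w≁y = mid-leaf-adj x≢w y≢w w~x w≁y
    ... | leaf-kind x≢w w≁x | mid-kind y≢w w~y =
      trans (ssAdjV-sym (leaf (branch x≢w)) (mid (branch y≢w))) (trans (mid-leaf-adj y≢w x≢w w~y w≁x) (adj-sym T y x))
    ... | leaf-kind x≢w w≁x | leaf-kind y≢w w≁y = sym (leaf-leaf-nonadjacent x≢w y≢w w≁x w≁y)

    isSubdividedStar : IsSubdividedStar T
    isSubdividedStar = subdividedStar-from T classify vertex vertex-classify classify-vertex classify-adj

  subdividedStar : ∀ {c} (P : BlockPartition c) w → BlockPartition.partner P w ≡ w →
                   (∀ x → BlockPartition.partner P x ≡ x → x ≡ w) →
                   (∀ x → x ≢ w → w ~ x ⊎ w ~ BlockPartition.partner P x) → IsSubdividedStar T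
  subdividedStar {zero} P w _ _ _ with BlockPartition.block P w
  ... | ()
  subdividedStar {suc t} P w w-exposed w-unique near = Star.isSubdividedStar P w w-exposed w-unique near

module TreeSplit {m} (T : Graph m) (acyclic : ¬ HasCycle T) (connected : Connected T) (k : ℕ)
                 (αT : IsAlpha T AllV (suc (suc (suc k)))) (notStar : ¬ IsSubdividedStar T) where

  open Adjacency T
  open Forest T acyclic
  open Splitting T
  open Blocks T acyclic k (proj₂ αT)

  exists-neighbour : ∀ v → Σ (Fin m) (v ~_)
  exists-neighbour v = firstStep (connected v other) other≢v
    where
    s : Fin (suc (suc (suc k))) → Fin m
    s = proj₁ (proj₁ αT)
    s₀≢s₁ : s zero ≢ s (suc zero)
    s₀≢s₁ e with proj₁ (proj₂ (proj₂ (proj₁ αT))) zero (suc zero) e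
    ... | ()
    other : Fin m
    other with s zero ≟ v
    ... | yes _ = s (suc zero)
    ... | no _ = s zero
    other≢v : other ≢ v
    other≢v with s zero ≟ v
    ... | yes s₀≡v = λ s₁≡v → s₀≢s₁ (trans s₀≡v (sym s₁≡v))
    ... | no s₀≢v = s₀≢v
    firstStep : ∀ {u} → Walk T v u → u ≢ v → Σ (Fin m) (v ~_)
    firstStep here u≢v = ⊥-elim (u≢v refl)
    firstStep (step v~z _) _ = _ , v~z

  module AtExposed {c} (P : BlockPartition c) (w : Fin m) (w-exposed : BlockPartition.partner P w ≡ w)
                   (w-unique : ∀ x → BlockPartition.partner P x ≡ x → x ≡ w) where
    open BlockPartition P
    open UniquelyExposed P w w-exposed w-unique

    Far : Fin m → Set
    Far x = x ≢ w × w ≁ x × w ≁ partner x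

    far? : ∀ x → Dec (Far x)
    far? x = ¬? (x ≟ w) ×-dec (adj T w x ≟ᵇ false) ×-dec (adj T w (partner x) ≟ᵇ false)

    far-exists : Σ (Fin m) Far
    far-exists with any? far?
    ... | yes far = far
    ... | no noFar = ⊥-elim (notStar (subdividedStar P w w-exposed w-unique near))
      where
      near : ∀ x → x ≢ w → w ~ x ⊎ w ~ partner x
      near x x≢w with adj T w x in w?x | adj T w (partner x) in w?px
      ... | true | _ = inj₁ refl
      ... | false | true = inj₂ refl
      ... | false | false = ⊥-elim (noFar (x , x≢w , w?x , w?px))

    record Pendant : Set where
      field
        z x    : Fin m
        w~z    : w ~ z
        pz~x   : partner z ~ x
        w≁x    : w ≁ x
        only-z : ∀ {z′} → w ~ z′ → z′ ≡ z

    crossFromNeighbour : ∀ {H a b} → Monotone H → HoldsOnStableSets H → a ~ b → w ~ a → Far b →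
                         Split (suc (suc k)) H
    crossFromNeighbour {a = a} {b} mono onStable a~b w~a (b≢w , _ , w≁pb) =
      crossPair mono onStable a~b a≢w b≢w b≢pa (¬-not λ w~pa → no-cycle₃ w~a (~partner a≢w) (adj-flip T w~pa)) w≁pb
      where
      a≢w : a ≢ w
      a≢w = neighbour≢w w~a
      b≢pa : b ≢ partner a
      b≢pa b≡pa = ≁⇒¬~ w≁pb (subst (w ~_) (sym (trans (cong partner b≡pa) (partner-involutive a))) w~a)

    -- After rematching along w z₂, the vertex partner z₂ is exposed and a ~ b becomes a crossing pair.
    crossAfterRematch : ∀ {H a b z₂} → Monotone H → HoldsOnStableSets H → a ~ b → a ≢ w → ¬ w ~ a →
                        w ~ partner a → Far b → w ~ z₂ → z₂ ≢ partner a → Split (suc (suc k)) H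
    crossAfterRematch {a = a} {b} {z₂} mono onStable a~b a≢w ¬w~a w~pa (b≢w , w≁b , w≁pb) w~z₂ z₂≢pa =
      UniquelyExposed.crossPair P′ (partner z₂) pz-exposed pz-unique mono onStable a~b
        a≢pz₂ b≢pz₂ (subst (b ≢_) (sym a-unchanged) b≢pa)
        (subst (partner z₂ ≁_) (sym a-unchanged) pz₂≁pa) (subst (partner z₂ ≁_) (sym b-unchanged) pz₂≁pb)
      where
      open Rematching w~z₂
      z₂≢w : z₂ ≢ w
      z₂≢w = neighbour≢w w~z₂
      b≢pa : b ≢ partner a
      b≢pa b≡pa = ≁⇒¬~ w≁b (subst (w ~_) (sym b≡pa) w~pa)
      a≢pz₂ : a ≢ partner z₂
      a≢pz₂ a≡pz₂ = z₂≢pa (sym (trans (cong partner a≡pz₂) (partner-involutive z₂)))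
      b≢pz₂ : b ≢ partner z₂
      b≢pz₂ b≡pz₂ = ≁⇒¬~ w≁pb (subst (w ~_) (sym (trans (cong partner b≡pz₂) (partner-involutive z₂))) w~z₂)
      a-unchanged : BlockPartition.partner P′ a ≡ partner a
      a-unchanged = unchanged a≢w (λ a≡z₂ → ¬w~a (subst (w ~_) (sym a≡z₂) w~z₂)) a≢pz₂
      b-unchanged : BlockPartition.partner P′ b ≡ partner b
      b-unchanged = unchanged b≢w (λ b≡z₂ → ≁⇒¬~ w≁b (subst (w ~_) (sym b≡z₂) w~z₂)) b≢pz₂
      pz₂≁pa : partner z₂ ≁ partner a
      pz₂≁pa = ¬-not λ pz₂~pa → no-cycle₄ w~z₂ (~partner z₂≢w) pz₂~pa (adj-flip T w~pa)
                                 (≢-sym (partner≢w z₂≢w)) z₂≢pa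
      pz₂≁pb : partner z₂ ≁ partner b
      pz₂≁pb = ¬-not λ pz₂~pb → no-cycle₇ (adj-flip T (~partner z₂≢w)) (adj-flip T w~z₂) w~pa
                 (adj-flip T (~partner a≢w)) a~b (~partner b≢w) (adj-flip T pz₂~pb)
                 (partner≢w z₂≢w) z₂≢pa (≢-sym a≢w) (≢-sym b≢pa)
                 (λ a≡pb → b≢pa (sym (trans (cong partner a≡pb) (partner-involutive b)))) b≢pz₂
                 (λ pb≡z₂ → ≁⇒¬~ w≁pb (subst (w ~_) (sym pb≡z₂) w~z₂))

    partner-near : ∀ {a b} → ¬ Far a → Far b → a ~ b → ¬ w ~ a → a ≢ w × w ~ partner a
    partner-near {a} {b} ¬far-a (_ , w≁b , _) a~b ¬w~a = a≢w , ¬-not λ w≁pa → ¬far-a (a≢w , ¬-not ¬w~a , w≁pa)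
      where
      a≢w : a ≢ w
      a≢w a≡w = ≁⇒¬~ w≁b (subst (_~ b) a≡w a~b)

    splitOrPendant : ∀ {H} → Monotone H → HoldsOnStableSets H → Split (suc (suc k)) H ⊎ Pendant
    splitOrPendant {H} mono onStable with far-exists
    ... | y , far-y with walk-crosses T Far far? (connected w y) (λ far-w → proj₁ far-w refl) far-y
    ...   | a , b , ¬far-a , far-b , a~b with adj T w a ≟ᵇ true
    ...     | yes w~a = inj₁ (crossFromNeighbour mono onStable a~b w~a far-b)
    ...     | no ¬w~a with partner-near ¬far-a far-b a~b ¬w~a
                             | any? (λ z₂ → (adj T w z₂ ≟ᵇ true) ×-dec ¬? (z₂ ≟ partner a))
    ...       | a≢w , w~pa | yes (z₂ , w~z₂ , z₂≢pa) =
                  inj₁ (crossAfterRematch mono onStable a~b a≢w ¬w~a w~pa far-b w~z₂ z₂≢pa)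
    ...       | _ , w~pa | no noOther = inj₂ (record
                  { z = partner a ; x = b ; w~z = w~pa ; pz~x = subst (_~ b) (sym (partner-involutive a)) a~b
                  ; w≁x = proj₁ (proj₂ far-b) ; only-z = only-pa })
      where
      only-pa : ∀ {z′} → w ~ z′ → z′ ≡ partner a
      only-pa {z′} w~z′ with z′ ≟ partner a
      ... | yes e = e
      ... | no ne = ⊥-elim (noOther (z′ , w~z′ , ne))

    p₃Split : ∀ {H} → Monotone H → HoldsOnInducedP₃ H → Split (suc (suc k)) H
    p₃Split mono onP₃ = mergeWith P mono w-exposed z≢w
      (onP₃ (≢-sym (partner≢w z≢w)) w~z (~partner z≢w) (¬-not λ w~pz → no-cycle₃ w~z (~partner z≢w) (adj-flip T w~pz)))
      where
      z = proj₁ (exists-neighbour w)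
      w~z = proj₂ (exists-neighbour w)
      z≢w = neighbour≢w w~z

    k₂+k₁Split : ∀ {H} → Monotone H → HoldsOnInducedK₂+K₁ H → Split (suc (suc k)) H
    k₂+k₁Split mono onK₂+K₁ =
      mergeWith P mono w-exposed x≢w (onK₂+K₁ (≢-sym x≢w) (≢-sym (partner≢w x≢w)) w≁x w≁px (~partner x≢w))
      where
      x = proj₁ far-exists
      x≢w = proj₁ (proj₂ far-exists)
      w≁x = proj₁ (proj₂ (proj₂ far-exists))
      w≁px = proj₂ (proj₂ (proj₂ far-exists))

  stableSplit : ∀ {c H} (P : BlockPartition c) w (w-exposed : BlockPartition.partner P w ≡ w)
                (w-unique : ∀ x → BlockPartition.partner P x ≡ x → x ≡ w) →
                Monotone H → HoldsOnStableSets H → Split (suc (suc k)) H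
  stableSplit P w w-exposed w-unique mono onStable =
    Sum.[ (λ split → split) , fromPendant ]′ (AtExposed.splitOrPendant P w w-exposed w-unique mono onStable)
    where
    open BlockPartition P
    open UniquelyExposed P w w-exposed w-unique using (module Rematching; ~partner; neighbour≢w)

    -- A pendant w can be traded for partner z, which has the two neighbours z and x and so is no pendant.
    fromPendant : AtExposed.Pendant P w w-exposed w-unique → Split (suc (suc k)) _
    fromPendant pendant =
      Sum.[ (λ split → split) , (λ pendant′ → ⊥-elim (≁⇒¬~ w≁x (subst (w ~_) (z≡x pendant′) w~z))) ]′
        (AtExposed.splitOrPendant P′ (partner z) pz-exposed pz-unique mono onStable)
      where
      open AtExposed.Pendant pendant
      open Rematching w~z
      z≡x : AtExposed.Pendant P′ (partner z) pz-exposed pz-unique → z ≡ x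
      z≡x pendant′ = trans (only-z′ (adj-flip T (~partner (neighbour≢w w~z)))) (sym (only-z′ pz~x))
        where only-z′ = AtExposed.Pendant.only-z pendant′

  uniqueExposedSplit : ∀ {c H} (P : BlockPartition c) w (w-exposed : BlockPartition.partner P w ≡ w)
                       (w-unique : ∀ x → BlockPartition.partner P x ≡ x → x ≡ w) →
                       Monotone H → Capable H → Split (suc (suc k)) H
  uniqueExposedSplit P w w-exposed w-unique mono (inj₁ onStable) = stableSplit P w w-exposed w-unique mono onStable
  uniqueExposedSplit P w w-exposed w-unique mono (inj₂ (_ , inj₁ onP₃)) =
    AtExposed.p₃Split P w w-exposed w-unique mono onP₃
  uniqueExposedSplit P w w-exposed w-unique mono (inj₂ (_ , inj₂ onK₂+K₁)) =
    AtExposed.k₂+k₁Split P w w-exposed w-unique mono onK₂+K₁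

  treeSplit : ¬ HasPerfectMatching T → ∀ {H} → Monotone H → Capable H → Split (suc (suc k)) H
  treeSplit noPerfectMatching {H} mono capable = withExposed (any? λ w → partner w ≟ w)
    where
    C : KonigCover ⊤
    C = konigCover ⊤
    P : BlockPartition (KonigCover.size C)
    P = konigBlockPartition C
    open BlockPartition P

    twoExposed : ∀ {w w₂} → partner w ≡ w → partner w₂ ≡ w₂ → w₂ ≢ w → Split (suc (suc k)) H
    twoExposed {w} {w₂} w-exposed w₂-exposed w₂≢w = mergeWith P mono w-exposed w₂≢w (pairSpecial capable)
      where
      w≁w₂ : w ≁ w₂
      w≁w₂ = exposed-nonadjacent C ∈⊤ ∈⊤ w-exposed w₂-exposed
      inPair : ∀ v → Triple w w₂ (partner w₂) v → Pair w w₂ v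
      inPair v (inj₁ v≡w) = inj₁ v≡w
      inPair v (inj₂ (inj₁ v≡w₂)) = inj₂ v≡w₂
      inPair v (inj₂ (inj₂ v≡pw₂)) = inj₂ (trans v≡pw₂ w₂-exposed)
      pairSpecial : Capable H → H (Triple w w₂ (partner w₂))
      pairSpecial (inj₁ onStable) = onStable (triple-stable w≁w₂ (subst (w ≁_) (sym w₂-exposed) w≁w₂)
                                                           (subst (w₂ ≁_) (sym w₂-exposed) (adj-irrefl T w₂)))
      pairSpecial (inj₂ (onNonEdge , _)) = mono inPair (onNonEdge (≢-sym w₂≢w) w≁w₂)

    withExposed : Dec (Σ (Fin m) λ w → partner w ≡ w) → Split (suc (suc k)) H
    withExposed (no none) =
      ⊥-elim (noPerfectMatching (partner , (λ v → partner-adjacent v (λ e → none (v , e))) , partner-involutive))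
    withExposed (yes (w , w-exposed)) with any? (λ w₂ → (partner w₂ ≟ w₂) ×-dec ¬? (w₂ ≟ w))
    ... | yes (w₂ , w₂-exposed , w₂≢w) = twoExposed w-exposed w₂-exposed w₂≢w
    ... | no noOther = uniqueExposedSplit P w w-exposed w-unique mono capable
      where
      w-unique : ∀ x → partner x ≡ x → x ≡ w
      w-unique x x-exposed with x ≟ w
      ... | yes x≡w = x≡w
      ... | no x≢w = ⊥-elim (noOther (x , x-exposed , x≢w))

module Host {m n} (T : Graph m) (G : Graph n) where

  open Adjacency T
  module G = Adjacency G
  open Splitting T

  embedUniform : ∀ {X Y} (b : Bool) (h : Fin m → Fin n) → (∀ i → X (h i)) → (∀ i j → h i ≡ h j → i ≡ j) →
                 (∀ i j → i ≢ j → adj G (h i) (h j) ≡ b) → (∀ {u v} → Y u → Y v → u ≢ v → adj T u v ≡ b) →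
                 Embeds T Y G X
  embedUniform b h h∈X h-injective h-uniform Y-uniform =
    h , (λ y _ → h∈X y) , (λ y y′ _ _ → h-injective y y′) , preserves
    where
    preserves : ∀ y y′ → _ → _ → adj G (h y) (h y′) ≡ adj T y y′
    preserves y y′ y∈Y y′∈Y with y ≟ y′
    ... | yes refl = trans (adj-irrefl G (h y)) (sym (adj-irrefl T y))
    ... | no y≢y′ = trans (h-uniform y y′ y≢y′) (sym (Y-uniform y∈Y y′∈Y y≢y′))

  adj≡adj-flip : ∀ {x y a b} → adj G x y ≡ adj T a b → adj G y x ≡ adj T b a
  adj≡adj-flip {x} {y} {a} {b} e = trans (adj-sym G y x) (trans e (adj-sym T a b))

  pick : Fin m → Fin m → Fin n → Fin n → Fin n → Fin m → Fin n
  pick a b x₁ x₂ x₃ y with y ≟ a | y ≟ b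
  ... | yes _ | _ = x₁
  ... | no _ | yes _ = x₂
  ... | no _ | no _ = x₃

  pick-a : ∀ {a b x₁ x₂ x₃} → pick a b x₁ x₂ x₃ a ≡ x₁
  pick-a {a} with a ≟ a
  ... | yes _ = refl
  ... | no a≢a = ⊥-elim (a≢a refl)

  pick-b : ∀ {a b x₁ x₂ x₃} → a ≢ b → pick a b x₁ x₂ x₃ b ≡ x₂
  pick-b {a} {b} a≢b with b ≟ a | b ≟ b
  ... | yes b≡a | _ = ⊥-elim (a≢b (sym b≡a))
  ... | no _ | yes _ = refl
  ... | no _ | no b≢b = ⊥-elim (b≢b refl)

  pick-c : ∀ {a b c x₁ x₂ x₃} → a ≢ c → b ≢ c → pick a b x₁ x₂ x₃ c ≡ x₃
  pick-c {a} {b} {c} a≢c b≢c with c ≟ a | c ≟ b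
  ... | yes c≡a | _ = ⊥-elim (a≢c (sym c≡a))
  ... | no _ | yes c≡b = ⊥-elim (b≢c (sym c≡b))
  ... | no _ | no _ = refl

  embedPair : ∀ {X a b x₁ x₂} → a ≢ b → x₁ ≢ x₂ → X x₁ → X x₂ → adj G x₁ x₂ ≡ adj T a b → Embeds T (Pair a b) G X
  embedPair {X} {a} {b} {x₁} {x₂} a≢b x₁≢x₂ x₁∈X x₂∈X e = f , f∈X , f-injective , f-adj
    where
    f : Fin m → Fin n
    f = pick a b x₁ x₂ x₂
    f-a : f a ≡ x₁
    f-a = pick-a {b = b} {x₂ = x₂} {x₃ = x₂}
    f-b : f b ≡ x₂
    f-b = pick-b a≢b
    f∈X : ∀ y → Pair a b y → X (f y)
    f∈X y (inj₁ refl) = subst X (sym f-a) x₁∈X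
    f∈X y (inj₂ refl) = subst X (sym f-b) x₂∈X
    f-injective : ∀ y y′ → Pair a b y → Pair a b y′ → f y ≡ f y′ → y ≡ y′
    f-injective y y′ (inj₁ refl) (inj₁ refl) _ = refl
    f-injective y y′ (inj₁ refl) (inj₂ refl) e′ = ⊥-elim (x₁≢x₂ (trans (sym f-a) (trans e′ f-b)))
    f-injective y y′ (inj₂ refl) (inj₁ refl) e′ = ⊥-elim (x₁≢x₂ (trans (sym f-a) (trans (sym e′) f-b)))
    f-injective y y′ (inj₂ refl) (inj₂ refl) _ = refl
    f-adj : ∀ y y′ → Pair a b y → Pair a b y′ → adj G (f y) (f y′) ≡ adj T y y′
    f-adj y y′ (inj₁ refl) (inj₁ refl) = trans (adj-irrefl G (f y)) (sym (adj-irrefl T y))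
    f-adj y y′ (inj₁ refl) (inj₂ refl) = trans (cong₂ (adj G) f-a f-b) e
    f-adj y y′ (inj₂ refl) (inj₁ refl) = trans (cong₂ (adj G) f-b f-a) (adj≡adj-flip e)
    f-adj y y′ (inj₂ refl) (inj₂ refl) = trans (adj-irrefl G (f y)) (sym (adj-irrefl T y))

  embedTriple : ∀ {X a b c x₁ x₂ x₃} → a ≢ b → a ≢ c → b ≢ c → x₁ ≢ x₂ → x₁ ≢ x₃ → x₂ ≢ x₃ →
                X x₁ → X x₂ → X x₃ → adj G x₁ x₂ ≡ adj T a b → adj G x₁ x₃ ≡ adj T a c → adj G x₂ x₃ ≡ adj T b c →
                Embeds T (Triple a b c) G X
  embedTriple {X} {a} {b} {c} {x₁} {x₂} {x₃} a≢b a≢c b≢c x₁≢x₂ x₁≢x₃ x₂≢x₃ x₁∈X x₂∈X x₃∈X e₁₂ e₁₃ e₂₃ =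
    f , f∈X , f-injective , f-adj
    where
    f : Fin m → Fin n
    f = pick a b x₁ x₂ x₃
    f-a : f a ≡ x₁
    f-a = pick-a {b = b} {x₂ = x₂} {x₃ = x₃}
    f-b : f b ≡ x₂
    f-b = pick-b a≢b
    f-c : f c ≡ x₃
    f-c = pick-c a≢c b≢c
    f∈X : ∀ y → Triple a b c y → X (f y)
    f∈X y (inj₁ refl) = subst X (sym f-a) x₁∈X
    f∈X y (inj₂ (inj₁ refl)) = subst X (sym f-b) x₂∈X
    f∈X y (inj₂ (inj₂ refl)) = subst X (sym f-c) x₃∈X
    f-injective : ∀ y y′ → Triple a b c y → Triple a b c y′ → f y ≡ f y′ → y ≡ y′
    f-injective y y′ (inj₁ refl) (inj₁ refl) _ = refl
    f-injective y y′ (inj₁ refl) (inj₂ (inj₁ refl)) e = ⊥-elim (x₁≢x₂ (trans (sym f-a) (trans e f-b)))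
    f-injective y y′ (inj₁ refl) (inj₂ (inj₂ refl)) e = ⊥-elim (x₁≢x₃ (trans (sym f-a) (trans e f-c)))
    f-injective y y′ (inj₂ (inj₁ refl)) (inj₁ refl) e = ⊥-elim (x₁≢x₂ (trans (sym f-a) (trans (sym e) f-b)))
    f-injective y y′ (inj₂ (inj₁ refl)) (inj₂ (inj₁ refl)) _ = refl
    f-injective y y′ (inj₂ (inj₁ refl)) (inj₂ (inj₂ refl)) e = ⊥-elim (x₂≢x₃ (trans (sym f-b) (trans e f-c)))
    f-injective y y′ (inj₂ (inj₂ refl)) (inj₁ refl) e = ⊥-elim (x₁≢x₃ (trans (sym f-a) (trans (sym e) f-c)))
    f-injective y y′ (inj₂ (inj₂ refl)) (inj₂ (inj₁ refl)) e = ⊥-elim (x₂≢x₃ (trans (sym f-b) (trans (sym e) f-c)))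
    f-injective y y′ (inj₂ (inj₂ refl)) (inj₂ (inj₂ refl)) _ = refl
    f-adj : ∀ y y′ → Triple a b c y → Triple a b c y′ → adj G (f y) (f y′) ≡ adj T y y′
    f-adj y y′ (inj₁ refl) (inj₁ refl) = trans (adj-irrefl G (f y)) (sym (adj-irrefl T y))
    f-adj y y′ (inj₁ refl) (inj₂ (inj₁ refl)) = trans (cong₂ (adj G) f-a f-b) e₁₂
    f-adj y y′ (inj₁ refl) (inj₂ (inj₂ refl)) = trans (cong₂ (adj G) f-a f-c) e₁₃
    f-adj y y′ (inj₂ (inj₁ refl)) (inj₁ refl) = trans (cong₂ (adj G) f-b f-a) (adj≡adj-flip e₁₂)
    f-adj y y′ (inj₂ (inj₁ refl)) (inj₂ (inj₁ refl)) = trans (adj-irrefl G (f y)) (sym (adj-irrefl T y))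
    f-adj y y′ (inj₂ (inj₁ refl)) (inj₂ (inj₂ refl)) = trans (cong₂ (adj G) f-b f-c) e₂₃
    f-adj y y′ (inj₂ (inj₂ refl)) (inj₁ refl) = trans (cong₂ (adj G) f-c f-a) (adj≡adj-flip e₁₃)
    f-adj y y′ (inj₂ (inj₂ refl)) (inj₂ (inj₁ refl)) = trans (cong₂ (adj G) f-c f-b) (adj≡adj-flip e₂₃)
    f-adj y y′ (inj₂ (inj₂ refl)) (inj₂ (inj₂ refl)) = trans (adj-irrefl G (f y)) (sym (adj-irrefl T y))

  InducedP₃In InducedK₂+K₁In : VSet n → Set
  InducedP₃In X = Σ (Fin n) λ x₁ → Σ (Fin n) λ x₂ → Σ (Fin n) λ x₃ →
    X x₁ × X x₂ × X x₃ × x₁ ≢ x₃ × x₁ G.~ x₂ × x₂ G.~ x₃ × x₁ G.≁ x₃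
  InducedK₂+K₁In X = Σ (Fin n) λ x₁ → Σ (Fin n) λ x₂ → Σ (Fin n) λ x₃ →
    X x₁ × X x₂ × X x₃ × x₁ ≢ x₂ × x₁ ≢ x₃ × x₁ G.≁ x₂ × x₁ G.≁ x₃ × x₂ G.~ x₃

  three-in-pair : ∀ {a b x y z : Fin n} → x ≢ y → x ≢ z → y ≢ z → Pair a b x → Pair a b y → Pair a b z → ⊥
  three-in-pair x≢y _ _ (inj₁ refl) (inj₁ refl) _ = x≢y refl
  three-in-pair _ x≢z _ (inj₁ refl) (inj₂ refl) (inj₁ refl) = x≢z refl
  three-in-pair _ _ y≢z (inj₁ refl) (inj₂ refl) (inj₂ refl) = y≢z refl
  three-in-pair _ _ y≢z (inj₂ refl) (inj₁ refl) (inj₁ refl) = y≢z refl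
  three-in-pair _ x≢z _ (inj₂ refl) (inj₁ refl) (inj₂ refl) = x≢z refl
  three-in-pair x≢y _ _ (inj₂ refl) (inj₂ refl) _ = x≢y refl

  off-pair : (h : Fin m → Fin n) → (∀ i j → h i ≡ h j → i ≡ j) → ∀ {i j l : Fin m} → i ≢ j → i ≢ l → j ≢ l →
             ∀ a b → Σ (Fin m) λ i₀ → Σ (Fin m) λ i₁ → i₀ ≢ i₁ × h i₀ ≢ a × h i₀ ≢ b
  off-pair h h-injective {i} {j} {l} i≢j i≢l j≢l a b with any? (λ x → ¬? (h x ≟ a) ×-dec ¬? (h x ≟ b))
  ... | no none = ⊥-elim (three-in-pair (h-≢ i≢j) (h-≢ i≢l) (h-≢ j≢l) (inPair i) (inPair j) (inPair l))
    where
    h-≢ : ∀ {x y} → x ≢ y → h x ≢ h y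
    h-≢ x≢y e = x≢y (h-injective _ _ e)
    inPair : ∀ x → Pair a b (h x)
    inPair x with h x ≟ a | h x ≟ b
    ... | yes e | _ = inj₁ e
    ... | no _ | yes e = inj₂ e
    ... | no ≢a | no ≢b = ⊥-elim (none (x , ≢a , ≢b))
  ... | yes (i₀ , ≢a , ≢b) with i ≟ i₀
  ...   | yes i≡i₀ = i₀ , j , (λ i₀≡j → i≢j (trans i≡i₀ i₀≡j)) , ≢a , ≢b
  ...   | no i≢i₀ = i₀ , i , ≢-sym i≢i₀ , ≢a , ≢b

  -- c is a clique vertex off the non-edge {a, b} and d another one; their adjacencies decide the shape.
  p₃-or-k₂+k₁ : ∀ {X} → HasClique G X m → ∀ {i j l : Fin m} → i ≢ j → i ≢ l → j ≢ l →
                ∀ {a b} → X a → X b → a ≢ b → a G.≁ b → InducedP₃In X ⊎ InducedK₂+K₁In X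
  p₃-or-k₂+k₁ {X} (h , h∈X , h-injective , h-clique) i≢j i≢l j≢l {a} {b} a∈X b∈X a≢b a≁b
    with off-pair h h-injective i≢j i≢l j≢l a b
  ... | i₀ , i₁ , i₀≢i₁ , c≢a , c≢b = shape (adj G c a ≟ᵇ true) (adj G c b ≟ᵇ true) (adj G d a ≟ᵇ true)
    where
    c d : Fin n
    c = h i₀
    d = h i₁
    c~d : c G.~ d
    c~d = h-clique i₀ i₁ i₀≢i₁
    shape : Dec (c G.~ a) → Dec (c G.~ b) → Dec (d G.~ a) → InducedP₃In X ⊎ InducedK₂+K₁In X
    shape (yes c~a) (yes c~b) _ = inj₁ (a , c , b , a∈X , h∈X i₀ , b∈X , a≢b , adj-flip G c~a , c~b , a≁b)
    shape (yes c~a) (no ¬c~b) _ =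
      inj₂ (b , c , a , b∈X , h∈X i₀ , a∈X , ≢-sym c≢b , ≢-sym a≢b , adj-flip G (¬-not ¬c~b) , adj-flip G a≁b , c~a)
    shape (no ¬c~a) (yes c~b) _ =
      inj₂ (a , c , b , a∈X , h∈X i₀ , b∈X , ≢-sym c≢a , a≢b , adj-flip G (¬-not ¬c~a) , a≁b , c~b)
    shape (no ¬c~a) (no _) (yes d~a) =
      inj₁ (a , d , c , a∈X , h∈X i₁ , h∈X i₀ , ≢-sym c≢a , adj-flip G d~a , adj-flip G c~d , adj-flip G (¬-not ¬c~a))
    shape (no ¬c~a) (no _) (no ¬d~a) =
      inj₂ (a , c , d , a∈X , h∈X i₀ , h∈X i₁ , ≢-sym c≢a , (λ a≡d → ¬c~a (subst (c G.~_) (sym a≡d) c~d))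
           , adj-flip G (¬-not ¬c~a) , adj-flip G (¬-not ¬d~a) , c~d)

  stableHost-capable : ∀ {X} → HasStable G X m → Capable (λ Y → Embeds T Y G X)
  stableHost-capable {X} (h , h∈X , h-injective , h-stable) =
    inj₁ λ Y-stable → embedUniform {X} false h h∈X h-injective h-stable (λ u∈Y v∈Y _ → Y-stable u∈Y v∈Y)

  cliqueHost-capable : ∀ {X} → HasClique G X m → ∀ {i j l : Fin m} → i ≢ j → i ≢ l → j ≢ l →
                       ∀ {a b} → X a → X b → a ≢ b → a G.≁ b → Capable (λ Y → Embeds T Y G X)
  cliqueHost-capable {X} clique i≢j i≢l j≢l {a} {b} a∈X b∈X a≢b a≁b =
    inj₂ (onNonEdge , Sum.map onP₃ onK₂+K₁ (p₃-or-k₂+k₁ clique i≢j i≢l j≢l a∈X b∈X a≢b a≁b))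
    where
    onNonEdge : HoldsOnNonEdges (λ Y → Embeds T Y G X)
    onNonEdge a′≢b′ a′≁b′ = embedPair a′≢b′ a≢b a∈X b∈X (trans a≁b (sym a′≁b′))
    onP₃ : InducedP₃In X → HoldsOnInducedP₃ (λ Y → Embeds T Y G X)
    onP₃ (x₁ , x₂ , x₃ , x₁∈ , x₂∈ , x₃∈ , x₁≢x₃ , x₁~x₂ , x₂~x₃ , x₁≁x₃) a′≢c′ a′~b′ b′~c′ a′≁c′ =
      embedTriple (edge⇒≢ T a′~b′) a′≢c′ (edge⇒≢ T b′~c′) (edge⇒≢ G x₁~x₂) x₁≢x₃ (edge⇒≢ G x₂~x₃) x₁∈ x₂∈ x₃∈
        (trans x₁~x₂ (sym a′~b′)) (trans x₁≁x₃ (sym a′≁c′)) (trans x₂~x₃ (sym b′~c′))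
    onK₂+K₁ : InducedK₂+K₁In X → HoldsOnInducedK₂+K₁ (λ Y → Embeds T Y G X)
    onK₂+K₁ (x₁ , x₂ , x₃ , x₁∈ , x₂∈ , x₃∈ , x₁≢x₂ , x₁≢x₃ , x₁≁x₂ , x₁≁x₃ , x₂~x₃) a′≢b′ a′≢c′ a′≁b′ a′≁c′ b′~c′ =
      embedTriple a′≢b′ a′≢c′ (edge⇒≢ T b′~c′) x₁≢x₂ x₁≢x₃ (edge⇒≢ G x₂~x₃) x₁∈ x₂∈ x₃∈
        (trans x₁≁x₂ (sym a′≁b′)) (trans x₁≁x₃ (sym a′≁c′)) (trans x₂~x₃ (sym b′~c′))

  embeds-mono : ∀ X → Monotone (λ Y → Embeds T Y G X)
  embeds-mono X Z⊆Y (f , f∈X , f-injective , f-adj) =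
    f , (λ y z → f∈X y (Z⊆Y y z)) , (λ y y′ z z′ → f-injective y y′ (Z⊆Y y z) (Z⊆Y y′ z′))
      , (λ y y′ z z′ → f-adj y y′ (Z⊆Y y z) (Z⊆Y y′ z′))

  split-embeds : ∀ {K} (X : Fin K → VSet n) (i₀ : Fin K) → (∀ j → j ≢ i₀ → HasClique G (X j) m) →
                 (S : Split K (λ Y → Embeds T Y G (X i₀))) → Split.special S ≡ i₀ →
                 ∀ j → Embeds T (Part (Split.label S) j) G (X j)
  split-embeds X i₀ cliques S refl j with j ≟ i₀
  ... | yes refl = Split.special-holds S
  ... | no j≢i₀ = embedUniform {X j} true h h∈X h-injective h-clique
                    (λ {u} u∈ v∈ u≢v → Split.clique S (trans u∈ (sym v∈)) (λ e → j≢i₀ (trans (sym u∈) e)) u≢v)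
    where
    h = proj₁ (cliques j j≢i₀)
    h∈X = proj₁ (proj₂ (cliques j j≢i₀))
    h-injective = proj₁ (proj₂ (proj₂ (cliques j j≢i₀)))
    h-clique = proj₂ (proj₂ (proj₂ (cliques j j≢i₀)))

module _ {n} (G : Graph n) where

  open Adjacency G

  nonedge-in-part : ∀ {c} → HasStable G AllV (suc c) → (q : Fin n → Fin c) →
                   Σ (Fin n) λ u → Σ (Fin n) λ v → q u ≡ q v × u ≢ v × u ≁ v
  nonedge-in-part {c} (s , _ , s-injective , s-stable) q with pigeonhole (n<1+n c) (λ i → q (s i))
  ... | i , j , i<j , same = s i , s j , same , (λ e → <⇒≢ i<j (s-injective i j e)) , s-stable i j (<⇒≢ i<j)

  embeds-into-clique : ∀ {m} {T : Graph m} {X Y} → IsClique G X → Embeds T Y G X →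
                       ∀ {u v} → Y u → Y v → u ≢ v → adj T u v ≡ true
  embeds-into-clique clique (f , f∈X , f-injective , f-adj) u∈Y v∈Y u≢v =
    trans (sym (f-adj _ _ u∈Y v∈Y)) (clique _ _ (f∈X _ u∈Y) (f∈X _ v∈Y) (λ e → u≢v (f-injective _ _ u∈Y v∈Y e)))

  clique⇒P4Free : ∀ {X} → IsClique G X → P4Free G X
  clique⇒P4Free {X} clique embedding
    with embeds-into-clique {T = P4} {X = X} {Y = AllV} clique embedding {zero} {suc (suc zero)} tt tt (λ ())
  ... | ()

  clique⇒¬stable : ∀ {X s} → IsClique G X → HasStable G X s → ∀ {i j : Fin s} → i ≢ j → ⊥
  clique⇒¬stable clique (h , h∈X , h-injective , h-stable) {i} {j} i≢j =
    ≁⇒¬~ (h-stable i j i≢j) (clique _ _ (h∈X i) (h∈X j) (λ e → i≢j (h-injective i j e)))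

module Certificates {m n} (k : ℕ) (T : Graph m) (G : Graph n) (acyclic : ¬ HasCycle T) (connected : Connected T)
                    (αT : IsAlpha T AllV (suc (suc (suc k)))) (noPerfectMatching : ¬ HasPerfectMatching T)
                    (notStar : ¬ IsSubdividedStar T) (p : Fin n → Fin (suc (suc k))) where

  open Adjacency T using (≁⇒¬~)
  open Splitting T using (Split; Capable; moveSpecial)
  open TreeSplit T acyclic connected k αT notStar using (treeSplit)
  open Host T G

  no-capable-part : Witnessing T G p → ∀ i₀ → (∀ j → j ≢ i₀ → HasClique G (Part p j) m) →
                    ¬ Capable (λ Y → Embeds T Y G (Part p i₀))
  no-capable-part witnessing i₀ cliques capable =
    let j , ¬embeds = witnessing (Split.label S) in ¬embeds (split-embeds (Part p) i₀ cliques S refl j)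
    where
    S : Split (suc (suc k)) (λ Y → Embeds T Y G (Part p i₀))
    S = moveSpecial (embeds-mono (Part p i₀)) (treeSplit noPerfectMatching (embeds-mono (Part p i₀)) capable) i₀

  α-vertex : Fin (suc (suc (suc k))) → Fin m
  α-vertex = proj₁ (proj₁ αT)

  α-vertex-≢ : ∀ {i j} → i ≢ j → α-vertex i ≢ α-vertex j
  α-vertex-≢ i≢j e = i≢j (proj₁ (proj₂ (proj₂ (proj₁ αT))) _ _ e)

  cliques⇒certifying : Interesting T G p → (∀ i → IsClique G (Part p i)) → Certifying T G p
  cliques⇒certifying (α-first , shapes) cliques =
    witnessing , α-first , ((λ j → clique-of (shapes (suc j))) , shapes zero) , (λ i → clique⇒P4Free G (cliques i))
    where
    witnessing : Witnessing T G p
    witnessing q with nonedge-in-part T (proj₁ αT) q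
    ... | u , v , same , u≢v , u≁v = q u , λ embeds →
      ≁⇒¬~ u≁v (embeds-into-clique G {T = T} {X = Part p (q u)} {Y = Part q (q u)}
                                   (cliques (q u)) embeds refl (sym same) u≢v)
    clique-of : ∀ {i} → HasClique G (Part p i) m ⊎ HasStable G (Part p i) m → HasClique G (Part p i) m
    clique-of (inj₁ clique) = clique
    clique-of {i} (inj₂ stable) = ⊥-elim (clique⇒¬stable G (cliques i) stable (α-vertex-≢ {zero} {suc zero} (λ ())))

  certifying⇒cliques : Certifying T G p → ∀ i → IsClique G (Part p i)
  certifying⇒cliques (witnessing , _ , (cliques , shape₀) , _) i u v u∈ v∈ u≢v = ¬-not (host shape₀)
    where
    host : HasClique G (Part p zero) m ⊎ HasStable G (Part p zero) m → adj G u v ≢ false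
    host (inj₂ stable₀) _ = no-capable-part witnessing zero nonzero (stableHost-capable {Part p zero} stable₀)
      where
      nonzero : ∀ j → j ≢ zero → HasClique G (Part p j) m
      nonzero zero 0≢0 = ⊥-elim (0≢0 refl)
      nonzero (suc j) _ = cliques j
    host (inj₁ clique₀) u≁v = no-capable-part witnessing i (λ j _ → cliqueAt j)
      (cliqueHost-capable {Part p i} (cliqueAt i) (α-vertex-≢ {zero} {suc zero} (λ ()))
                          (α-vertex-≢ {zero} {suc (suc zero)} (λ ())) (α-vertex-≢ {suc zero} {suc (suc zero)} (λ ()))
                          u∈ v∈ u≢v u≁v)
      where
      cliqueAt : ∀ j → HasClique G (Part p j) m
      cliqueAt zero = clique₀
      cliqueAt (suc j) = cliques j

mainTheorem11 : ∀ {m n} (k : ℕ) (T : Graph m) (G : Graph n)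
    → IsTree T
    → IsAlpha T AllV (suc (suc (suc k)))
    → ¬ HasPerfectMatching T
    → ¬ IsSubdividedStar T
    → (p : Fin n → Fin (suc (suc k)))
    → Interesting T G p
    → (Certifying T G p → (∀ i → IsClique G (Part p i)))
      × ((∀ i → IsClique G (Part p i)) → Certifying T G p)
mainTheorem11 k T G (_ , connected , acyclic) αT noPerfectMatching notStar p interesting =
  certifying⇒cliques , cliques⇒certifying interesting
  where open Certificates k T G acyclic connected αT noPerfectMatching notStar p
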